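{- Let $\mathcal{C}_{con}(G)$ denote the class of connected sets of a finite simple undirected graph $G$. Then: (1) for every finite tree $T$: $\mathrm{RTD}(\mathcal{C}_{con}(T))=\ell(T)$; (2) for every connected finite graph $G$: $\mathrm{RTD}(\mathcal{C}_{con}(G))\ge \ell(G)$; (3) for every finite graph $G$: $\ell(G)\le \mathrm{RTD}(\mathcal{C}_{con}(G))\le \ell(G)+1$.
   Context: For a graph $G=(V,E)$, $\mathcal{C}_{con}(G)$ is the concept class over domain $V$ consisting of the empty set together with all nonempty $X\subseteq V$ such that the subgraph of $G$ induced by $X$ is connected. For a connected graph $G$, $\ell(G)$ is the number of leaves (degree-1 vertices) of a spanning tree of $G$ with the maximum possible number of leaves; for a tree $T$, $\ell(T)$ is its number of leaves. For a graph with connected components $G_1,\dots,G_r$, $\ell(G)=\max_i \ell(G_i)$. For a finite concept class $\mathcal{C}$ over a finite domain $\mathcal{X}$, a teaching set for $C\in\mathcal{C}$ is $D\subseteq\mathcal{X}$ such that for every $C'\in\mathcal{C}\setminus\{C\}$ there is $x\in D$ with ($x\in C\iff x\notin C'$); $\mathrm{TD}(C,\mathcal{C})$ is the minimum size of such a set, $\mathrm{TD}_{min}(\mathcal{C})=\min_C\mathrm{TD}(C,\mathcal{C})$, $\mathcal{C}_{min}=\{C:\mathrm{TD}(C,\mathcal{C})=\mathrm{TD}_{min}(\mathcal{C})\}$, and $\mathrm{RTD}(\mathcal{C})=\mathrm{TD}_{min}(\mathcal{C})$ if $\mathcal{C}=\mathcal{C}_{min}$, otherwise $\max\{\mathrm{TD}_{min}(\mathcal{C}),\mathrm{RTD}(\mathcal{C}\setminus\mathcal{C}_{min})\}$.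 -}

module Defs where

open import Data.Nat using (ℕ; zero; suc; _≤_; _⊔_; _+_; _≡ᵇ_)
open import Data.Bool using (Bool; true; false)
open import Data.Fin using (Fin; zero; suc; inject₁; fromℕ)
open import Data.Fin.Subset public
  using (Subset; _∈_; _∉_; _⊆_; ∣_∣; Nonempty)
  renaming (⊤ to Full; ⊥ to Empty)
open import Data.Vec using (tabulate)
open import Data.Product using (Σ; _×_; _,_)
open import Data.Sum using (_⊎_)
open import Relation.Nullary using (¬_)
open import Relation.Binary.PropositionalEquality using (_≡_; _≢_)
open import Function.Definitions using (Injective)

record Graph (n : ℕ) : Set where
  field
    adj    : Fin n → Fin n → Bool
    sym    : ∀ u v → adj u v ≡ adj v u
    irrefl : ∀ u → adj u u ≡ false
open Graph public

Edge : ∀ {n} → Graph n → Fin n → Fin n → Set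
Edge G u v = adj G u v ≡ true

data PathIn {n} (G : Graph n) (X : Subset n) : Fin n → Fin n → Set where
  here : ∀ {u} → u ∈ X → PathIn G X u u
  step : ∀ {u v w} → u ∈ X → Edge G u v → PathIn G X v w → PathIn G X u w

ConnectedSet : ∀ {n} → Graph n → Subset n → Set
ConnectedSet G X = Nonempty X × (∀ u v → u ∈ X → v ∈ X → PathIn G X u v)

ConnectedGraph : ∀ {n} → Graph n → Set
ConnectedGraph G = ConnectedSet G Full

Acyclic : ∀ {n} → Graph n → Set
Acyclic {n} G =
  ∀ (k : ℕ) (c : Fin (suc (suc (suc k))) → Fin n) →
    Injective _≡_ _≡_ c →
    (∀ (i : Fin (suc (suc k))) → Edge G (c (inject₁ i)) (c (suc i))) →
    ¬ Edge G (c (fromℕ (suc (suc k)))) (c zero)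

IsTree : ∀ {n} → Graph n → Set
IsTree T = ConnectedGraph T × Acyclic T

degree : ∀ {n} → Graph n → Fin n → ℕ
degree G v = ∣ tabulate (adj G v) ∣

leaves : ∀ {n} → Graph n → ℕ
leaves G = ∣ tabulate (λ v → degree G v ≡ᵇ 1) ∣

SpanningTreeOn : ∀ {n} → Graph n → Subset n → Graph n → Set
SpanningTreeOn G X T =
  (∀ u v → Edge T u v → Edge G u v) ×
  (∀ u v → Edge T u v → u ∈ X) ×
  ConnectedSet T X × Acyclic T

-- m = max number of leaves of a spanning tree of G[X]   (ℓ(G[X]) = m)
IsMaxLeaf : ∀ {n} → Graph n → Subset n → ℕ → Set
IsMaxLeaf G X m =
  (Σ (Graph _) λ T → SpanningTreeOn G X T × leaves T ≡ m) ×
  (∀ T → SpanningTreeOn G X T → leaves T ≤ m)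

Component : ∀ {n} → Graph n → Subset n → Set
Component {n} G X =
  ConnectedSet G X × (∀ (Y : Subset n) → ConnectedSet G Y → X ⊆ Y → Y ≡ X)

-- ℓ(G) = m : the maximum of ℓ over the components (0 if there are none)
IsLeafNumber : ∀ {n} → Graph n → ℕ → Set
IsLeafNumber {n} G m =
  (∀ (X : Subset n) k → Component G X → IsMaxLeaf G X k → k ≤ m) ×
  (m ≡ 0 ⊎ Σ (Subset n) λ X → Component G X × IsMaxLeaf G X m)

ConceptClass : ℕ → Set₁
ConceptClass n = Subset n → Set

Ccon : ∀ {n} → Graph n → ConceptClass n
Ccon G C = C ≡ Empty ⊎ ConnectedSet G C

Distinguishes : ∀ {n} → Fin n → Subset n → Subset n → Set
Distinguishes x C C' = (x ∈ C × x ∉ C') ⊎ (x ∉ C × x ∈ C')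

Teaches : ∀ {n} → ConceptClass n → Subset n → Subset n → Set
Teaches {n} 𝒞 C D =
  ∀ (C' : Subset n) → 𝒞 C' → C' ≢ C →
    Σ (Fin n) λ x → x ∈ D × Distinguishes x C C'

HasTD : ∀ {n} → ConceptClass n → Subset n → ℕ → Set
HasTD {n} 𝒞 C k =
  (Σ (Subset n) λ D → Teaches 𝒞 C D × ∣ D ∣ ≡ k) ×
  (∀ (D : Subset n) → Teaches 𝒞 C D → k ≤ ∣ D ∣)

TDmin : ∀ {n} → ConceptClass n → ℕ → Set
TDmin {n} 𝒞 t =
  (Σ (Subset n) λ C → 𝒞 C × HasTD 𝒞 C t) ×
  (∀ (C : Subset n) k → 𝒞 C → HasTD 𝒞 C k → t ≤ k)

data RTDis {n} : ConceptClass n → ℕ → Set₁ where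
  done : ∀ {𝒞 t} → TDmin 𝒞 t →
         (∀ C → 𝒞 C → HasTD 𝒞 C t) →
         RTDis 𝒞 t
  step : ∀ {𝒞 t d} → TDmin 𝒞 t →
         ¬ (∀ C → 𝒞 C → HasTD 𝒞 C t) →
         RTDis (λ C → 𝒞 C × ¬ HasTD 𝒞 C t) d →
         RTDis 𝒞 (t ⊔ d)

{-# OPTIONS --safe #-}
module Submission where

-- Lower bound: if T is a spanning tree of a component X, the sets agreeing with X off the leaves
-- of T are connected and closed under toggling any leaf, so whichever of them the RTD recursion
-- removes first needs all ℓ(T) leaves in its teaching set.
-- Upper bound for a tree: in any subclass, a concept C of maximum size is taught by its own leaves
-- (the vertices with at most one neighbour in C); there are at most ℓ(T) of them, and a connected
-- set containing them all contains C.
-- Upper bound for a graph: a nonempty concept C of minimum size is taught by its neighbourhood and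
-- one vertex of C, and the neighbourhood can be attached as leaves to a spanning tree of C, so it
-- has at most ℓ(G) vertices.

open import Defs renaming (sym to adj-sym)
open import Level using (0ℓ)
open import Function using (_∘_; id; flip)
open import Function.Bundles using (module Equivalence; mk⇔)
open import Function.Definitions using (Injective)
open import Data.Empty using (⊥; ⊥-elim)
open import Data.Unit using (⊤; tt)
open import Data.Bool as Bool using (Bool; true; false; if_then_else_)
open import Data.Bool.Properties using (not-¬; T-≡)
open import Data.Product using (Σ; ∃; _×_; _,_; proj₁; proj₂)
open import Data.Sum as Sum using (_⊎_; inj₁; inj₂; [_,_]′)
open import Data.Nat as ℕ using (ℕ; zero; suc; _+_; _∸_; _⊔_; _≤_; _<_; z≤n; s≤s)
open import Data.Nat.Properties
  using (≤-refl; ≤-reflexive; ≤-trans; ≤-antisym; ≤-pred; <⇒≱; ≮⇒≥; ≰⇒>; <⇒≢; n≢0⇒n>0; n≤1+n; n<1+n;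
         m<n⇒m<1+n; ∸-monoʳ-<; +-identityʳ; +-suc; +-mono-≤; +-mono-<-≤; +-mono-≤-<;
         m≤n⇒m≤n⊔o; m≤n⇒m≤o⊔n; ⊔-lub; ≡ᵇ⇒≡; ≡⇒≡ᵇ; anyUpTo?; module ≤-Reasoning)
open import Data.Nat.Induction using (<-rec; <-wellFounded)
open import Data.Fin using (Fin; zero; suc; fromℕ; inject₁; toℕ)
open import Data.Fin.Properties using (_≟_; any?; all?; injective⇒≤; toℕ-inject₁; suc-injective)
open import Data.Fin.Subset using (inside; outside; ⁅_⁆; _─_; _-_; _∪_; _⊂_; ∁)
open import Data.Fin.Subset.Properties
  using (_∈?_; nonempty?; anySubset?; ∈⊤; ∉⊥; ⊥⊆; Empty-unique; ∣⊥∣≡0; ∣p∣≤n; ∣⁅x⁆∣≡1; x∈⁅x⁆; x∈⁅y⁆⇒x≡y;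
         ⊆-antisym; p⊆q⇒∣p∣≤∣q∣; p⊂q⇒∣p∣<∣q∣; p⊂q⇒∁p⊃∁q; p⊆p∪q; q⊆p∪q; x∈p∪q⁺; x∈p∪q⁻;
         ∪-identityʳ; p─q⊆p; x∈p∧x≢y⇒x∈p-y; x∈p⇒p-x⊂p; x∈p⇒∣p-x∣<∣p∣)
open import Data.Vec using (Vec; []; _∷_; lookup; tabulate; here; there; _[_]%=_)
open import Data.Vec.Properties
  using (lookup⇒[]=; []=⇒lookup; lookup∘tabulate; tabulate-cong; lookup∘updateAt; lookup∘updateAt′; ≡-dec)
open import Induction.WellFounded as WF using (WellFounded)
import Relation.Binary.Construct.On as On
open import Relation.Binary.PropositionalEquality
open import Relation.Nullary using (¬_; Dec; yes; no; does; contradiction)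
open import Relation.Nullary.Decidable
  using (dec-true; dec-false; does-⇔; decidable-stable; map′; ¬?; _×-dec_; _⊎-dec_; _→-dec_)
open import Relation.Unary using (Pred; Decidable)

-- Finite subsets and search

private variable
  n : ℕ
  x y : Fin n
  p q : Subset n
  A : Set

∈-tabulate⁺ : (f : Fin n → Bool) → f x ≡ true → x ∈ tabulate f
∈-tabulate⁺ {x = x} f fx = lookup⇒[]= x (tabulate f) (trans (lookup∘tabulate f x) fx)

∈-tabulate⁻ : (f : Fin n → Bool) → x ∈ tabulate f → f x ≡ true
∈-tabulate⁻ {x = x} f x∈ = trans (sym (lookup∘tabulate f x)) ([]=⇒lookup x∈)

does-true⇒ : ∀ {P : Set} (P? : Dec P) → does P? ≡ true → P
does-true⇒ (yes p) _ = p

⟦_⟧ : {P : Pred (Fin n) 0ℓ} → Decidable P → Subset n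
⟦ P? ⟧ = tabulate (does ∘ P?)

∈⟦⟧⁺ : {P : Pred (Fin n) 0ℓ} (P? : Decidable P) → P x → x ∈ ⟦ P? ⟧
∈⟦⟧⁺ {x = x} P? px = ∈-tabulate⁺ (does ∘ P?) (dec-true (P? x) px)

∈⟦⟧⁻ : {P : Pred (Fin n) 0ℓ} (P? : Decidable P) → x ∈ ⟦ P? ⟧ → P x
∈⟦⟧⁻ {x = x} P? x∈ = does-true⇒ (P? x) (∈-tabulate⁻ (does ∘ P?) x∈)

x∈p─q⇒x∉q : x ∈ p ─ q → x ∉ q
x∈p─q⇒x∉q {p = _ ∷ _} {q = outside ∷ _} here ()
x∈p─q⇒x∉q {p = _ ∷ _} {q = _ ∷ _} (there x∈) (there x∈q) = x∈p─q⇒x∉q x∈ x∈q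

x∈p-y⇒x≢y : x ∈ p - y → x ≢ y
x∈p-y⇒x≢y x∈ refl = x∈p─q⇒x∉q x∈ (x∈⁅x⁆ _)

x∈p-y⇒x∈p : x ∈ p - y → x ∈ p
x∈p-y⇒x∈p {p = p} {y = y} = p─q⊆p p ⁅ y ⁆

∣p∪⁅x⁆∣≤1+∣p∣ : ∀ (p : Subset n) x → ∣ p ∪ ⁅ x ⁆ ∣ ≤ suc ∣ p ∣
∣p∪⁅x⁆∣≤1+∣p∣ (inside  ∷ p) zero rewrite ∪-identityʳ p = n≤1+n _
∣p∪⁅x⁆∣≤1+∣p∣ (outside ∷ p) zero rewrite ∪-identityʳ p = ≤-refl
∣p∪⁅x⁆∣≤1+∣p∣ (inside  ∷ p) (suc x) = s≤s (∣p∪⁅x⁆∣≤1+∣p∣ p x)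
∣p∪⁅x⁆∣≤1+∣p∣ (outside ∷ p) (suc x) = ∣p∪⁅x⁆∣≤1+∣p∣ p x

∣p∣≤1+∣p-x∣ : ∀ (p : Subset n) x → ∣ p ∣ ≤ suc ∣ p - x ∣
∣p∣≤1+∣p-x∣ p x = ≤-trans (p⊆q⇒∣p∣≤∣q∣ p⊆p-x∪x) (∣p∪⁅x⁆∣≤1+∣p∣ (p - x) x)
  where
  p⊆p-x∪x : p ⊆ (p - x) ∪ ⁅ x ⁆
  p⊆p-x∪x {y} y∈p with y ≟ x
  ... | yes refl = x∈p∪q⁺ (inj₂ (x∈⁅x⁆ x))
  ... | no y≢x = x∈p∪q⁺ (inj₁ (x∈p∧x≢y⇒x∈p-y y∈p y≢x))

x∈p⇒0<∣p∣ : x ∈ p → 0 < ∣ p ∣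
x∈p⇒0<∣p∣ x∈p = ≤-trans (s≤s z≤n) (x∈p⇒∣p-x∣<∣p∣ x∈p)

0<∣p∣⇒Nonempty : 0 < ∣ p ∣ → Nonempty p
0<∣p∣⇒Nonempty {n} {p} 0<∣p∣ with nonempty? p
... | yes ne = ne
... | no ¬ne = contradiction (≤-reflexive (trans (cong ∣_∣ (Empty-unique ¬ne)) (∣⊥∣≡0 n))) (<⇒≱ 0<∣p∣)

distinct⇒2≤∣p∣ : x ∈ p → y ∈ p → x ≢ y → 2 ≤ ∣ p ∣
distinct⇒2≤∣p∣ {p = p} x∈p y∈p x≢y =
  ≤-trans (s≤s (x∈p⇒0<∣p∣ {p = p - _} (x∈p∧x≢y⇒x∈p-y y∈p (x≢y ∘ sym)))) (x∈p⇒∣p-x∣<∣p∣ x∈p)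

2≤∣p∣⇒distinct : 2 ≤ ∣ p ∣ → ∃ λ x → ∃ λ y → x ∈ p × y ∈ p × x ≢ y
2≤∣p∣⇒distinct {p = p} 2≤∣p∣ with 0<∣p∣⇒Nonempty (≤-trans (s≤s z≤n) 2≤∣p∣)
... | x , x∈p with 0<∣p∣⇒Nonempty {p = p - x} (≤-pred (≤-trans 2≤∣p∣ (∣p∣≤1+∣p-x∣ p x)))
... | y , y∈p-x = x , y , x∈p , x∈p-y⇒x∈p {p = p} y∈p-x , λ x≡y → x∈p-y⇒x≢y {p = p} y∈p-x (sym x≡y)

⊆∧∣∣≤⇒≡ : p ⊆ q → ∣ q ∣ ≤ ∣ p ∣ → p ≡ q
⊆∧∣∣≤⇒≡ {p = p} {q = q} p⊆q ∣q∣≤∣p∣ = ⊆-antisym p⊆q q⊆p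
  where
  q⊆p : q ⊆ p
  q⊆p {x} x∈q = decidable-stable (x ∈? p) λ x∉p → <⇒≱ (p⊂q⇒∣p∣<∣q∣ (p⊆q , x , x∈q , x∉p)) ∣q∣≤∣p∣

⊂-rec : (P : Subset n → Set) → (∀ X → (∀ {Y} → Y ⊂ X → P Y) → P X) → ∀ X → P X
⊂-rec P = WF.All.wfRec ⊂-wellFounded 0ℓ P
  where
  ⊂-wellFounded : WellFounded _⊂_
  ⊂-wellFounded = WF.Subrelation.wellFounded p⊂q⇒∣p∣<∣q∣ (On.wellFounded ∣_∣ <-wellFounded)

⊃-rec : (P : Subset n → Set) → (∀ X → (∀ {Y} → X ⊂ Y → P Y) → P X) → ∀ X → P X
⊃-rec P = WF.All.wfRec ⊃-wellFounded 0ℓ P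
  where
  ⊃-wellFounded : WellFounded (flip _⊂_)
  ⊃-wellFounded =
    WF.Subrelation.wellFounded (p⊂q⇒∣p∣<∣q∣ ∘ p⊂q⇒∁p⊃∁q) (On.wellFounded (∣_∣ ∘ ∁) <-wellFounded)

Searchable : Set → Set₁
Searchable A = ∀ {P : Pred A 0ℓ} → Decidable P → Dec (∃ P)

universal? : Searchable A → {P : Pred A 0ℓ} → Decidable P → Dec (∀ a → P a)
universal? search P? with search (¬? ∘ P?)
... | yes (a , ¬pa) = no λ ∀p → ¬pa (∀p a)
... | no ∄¬p = yes λ a → decidable-stable (P? a) λ ¬pa → ∄¬p (a , ¬pa)

Vec-searchable : Searchable A → ∀ m → Searchable (Vec A m)
Vec-searchable search zero P? = map′ ([] ,_) (λ { ([] , p) → p }) (P? [])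
Vec-searchable search (suc m) P? =
  map′ (λ (a , v , p) → a ∷ v , p) (λ { (a ∷ v , p) → a , v , p })
       (search λ a → Vec-searchable search m (P? ∘ (a ∷_)))

least : {P : Pred ℕ 0ℓ} → Decidable P → ∀ {k} → P k → ∃ λ m → P m × (∀ {j} → j < m → ¬ P j)
least {P = P} P? = <-rec (λ k → P k → ∃ λ m → P m × (∀ {j} → j < m → ¬ P j)) go _
  where
  go : ∀ k → (∀ {j} → j < k → P j → ∃ λ m → P m × (∀ {i} → i < m → ¬ P i)) →
       P k → ∃ λ m → P m × (∀ {j} → j < m → ¬ P j)
  go k below pk with anyUpTo? P? k
  ... | yes (j , j<k , pj) = below j<k pj
  ... | no ∄ = k , pk , λ j<k pj → ∄ (_ , j<k , pj)

argmin : Searchable A → (f : A → ℕ) {P : Pred A 0ℓ} → Decidable P →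
         ∀ {a} → P a → ∃ λ b → P b × (∀ {c} → P c → f b ≤ f c)
argmin search f P? pa with least (λ k → search λ b → P? b ×-dec (f b ℕ.≟ k)) (_ , pa , refl)
... | _ , (b , pb , refl) , below = b , pb , λ pc → ≮⇒≥ λ fc<fb → below fc<fb (_ , pc , refl)

argmax : Searchable A → (f : A → ℕ) → ∀ {N} → (∀ a → f a ≤ N) → {P : Pred A 0ℓ} → Decidable P →
         ∀ {a} → P a → ∃ λ b → P b × (∀ {c} → P c → f c ≤ f b)
argmax search f {N} bounded P? pa with argmin search (λ a → N ∸ f a) P? pa
... | b , pb , minimal =
  b , pb , λ pc → ≮⇒≥ λ fb<fc → <⇒≱ (∸-monoʳ-< fb<fc (bounded _)) (minimal pc)

maximum : ∀ {n} (f : Fin n → ℕ) {N} → (∀ v → f v ≤ N) → ∃ λ M → (∀ v → f v ≤ M) × (M ≡ 0 ⊎ ∃ λ v → f v ≡ M)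
maximum {zero}  f _       = 0 , (λ ()) , inj₁ refl
maximum {suc n} f bounded with argmax any? f bounded {P = λ _ → ⊤} (λ _ → yes tt) {zero} tt
... | v , _ , maximal = f v , (λ _ → maximal tt) , inj₂ (v , refl)

-- Teaching dimension and recursive teaching dimension

private variable
  𝒞 𝒬 : ConceptClass n
  C C' D L : Subset n

_≟ˢ_ : (p q : Subset n) → Dec (p ≡ q)
_≟ˢ_ = ≡-dec Bool._≟_

distinguishes? : ∀ x (C C' : Subset n) → Dec (Distinguishes x C C')
distinguishes? x C C' = ((x ∈? C) ×-dec ¬? (x ∈? C')) ⊎-dec (¬? (x ∈? C) ×-dec (x ∈? C'))

≢⇒distinguished : C' ≢ C → ∃ λ x → Distinguishes x C C'
≢⇒distinguished {C' = C'} {C = C} C'≢C with any? (λ x → distinguishes? x C C')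
... | yes d = d
... | no ∄ = contradiction (⊆-antisym C'⊆C C⊆C') C'≢C
  where
  C⊆C' : C ⊆ C'
  C⊆C' {x} x∈C = decidable-stable (x ∈? C') λ x∉C' → ∄ (x , inj₁ (x∈C , x∉C'))
  C'⊆C : C' ⊆ C
  C'⊆C {x} x∈C' = decidable-stable (x ∈? C) λ x∉C → ∄ (x , inj₂ (x∉C , x∈C'))

Full-teaches : ∀ C → Teaches 𝒞 C Full
Full-teaches C C' _ C'≢C with ≢⇒distinguished C'≢C
... | x , d = x , ∈⊤ , d

teaches? : Decidable 𝒞 → ∀ C → Decidable (Teaches 𝒞 C)
teaches? 𝒞? C D = universal? anySubset? λ C' →
  𝒞? C' →-dec (¬? (C' ≟ˢ C) →-dec any? λ x → (x ∈? D) ×-dec distinguishes? x C C')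

HasTD-exists : Decidable 𝒞 → ∀ C → ∃ (HasTD 𝒞 C)
HasTD-exists 𝒞? C with argmin anySubset? ∣_∣ (teaches? 𝒞? C) (Full-teaches C)
... | D , D-teaches , minimal = ∣ D ∣ , (D , D-teaches , refl) , λ _ → minimal

HasTD-unique : ∀ {k k'} → HasTD 𝒞 C k → HasTD 𝒞 C k' → k ≡ k'
HasTD-unique ((D , D-teaches , refl) , minimal) ((D' , D'-teaches , refl) , minimal') =
  ≤-antisym (minimal D' D'-teaches) (minimal' D D-teaches)

HasTD? : Decidable 𝒞 → ∀ C → Decidable (HasTD 𝒞 C)
HasTD? 𝒞? C k with HasTD-exists 𝒞? C
... | k₀ , td₀ = map′ (λ { refl → td₀ }) (λ td → HasTD-unique td td₀) (k ℕ.≟ k₀)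

TDmin-exists : Decidable 𝒞 → ∃ 𝒞 → ∃ (TDmin 𝒞)
TDmin-exists 𝒞? (_ , c₀) with argmin anySubset? (proj₁ ∘ HasTD-exists 𝒞?) 𝒞? c₀
... | C , c , minimal =
  _ , (C , c , proj₂ (HasTD-exists 𝒞? C)) ,
  λ C' k c' td → subst (_ ≤_) (HasTD-unique (proj₂ (HasTD-exists 𝒞? C')) td) (minimal c')

#[_] : {𝒞 : ConceptClass n} → Decidable 𝒞 → ℕ
#[_] {zero}  𝒞? = if does (𝒞? []) then 1 else 0
#[_] {suc n} 𝒞? = #[ 𝒞? ∘ (inside ∷_) ] + #[ 𝒞? ∘ (outside ∷_) ]

#-mono : {𝒟 : ConceptClass n} (𝒟? : Decidable 𝒟) (𝒞? : Decidable 𝒞) →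
         (∀ {C} → 𝒟 C → 𝒞 C) → #[ 𝒟? ] ≤ #[ 𝒞? ]
#-mono {zero} 𝒟? 𝒞? 𝒟⊆𝒞 with 𝒟? [] | 𝒞? []
... | yes d | no ¬c = contradiction (𝒟⊆𝒞 d) ¬c
... | yes _ | yes _ = ≤-refl
... | no _  | _     = z≤n
#-mono {suc n} 𝒟? 𝒞? 𝒟⊆𝒞 =
  +-mono-≤ (#-mono (𝒟? ∘ (inside ∷_)) (𝒞? ∘ (inside ∷_)) 𝒟⊆𝒞)
           (#-mono (𝒟? ∘ (outside ∷_)) (𝒞? ∘ (outside ∷_)) 𝒟⊆𝒞)

#-strict : {𝒟 : ConceptClass n} (𝒟? : Decidable 𝒟) (𝒞? : Decidable 𝒞) →
           (∀ {C} → 𝒟 C → 𝒞 C) → 𝒞 C → ¬ 𝒟 C → #[ 𝒟? ] < #[ 𝒞? ]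
#-strict {zero} {C = []} 𝒟? 𝒞? _ c ¬d with 𝒟? [] | 𝒞? []
... | yes d | _     = contradiction d ¬d
... | no _  | no ¬c = contradiction c ¬c
... | no _  | yes _ = s≤s z≤n
#-strict {suc n} {C = inside ∷ C} 𝒟? 𝒞? 𝒟⊆𝒞 c ¬d =
  +-mono-<-≤ (#-strict (𝒟? ∘ (inside ∷_)) (𝒞? ∘ (inside ∷_)) 𝒟⊆𝒞 c ¬d)
             (#-mono (𝒟? ∘ (outside ∷_)) (𝒞? ∘ (outside ∷_)) 𝒟⊆𝒞)
#-strict {suc n} {C = outside ∷ C} 𝒟? 𝒞? 𝒟⊆𝒞 c ¬d =
  +-mono-≤-< (#-mono (𝒟? ∘ (inside ∷_)) (𝒞? ∘ (inside ∷_)) 𝒟⊆𝒞)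
             (#-strict (𝒟? ∘ (outside ∷_)) (𝒞? ∘ (outside ∷_)) 𝒟⊆𝒞 c ¬d)

Rest : ConceptClass n → ℕ → ConceptClass n
Rest 𝒞 t C = 𝒞 C × ¬ HasTD 𝒞 C t

Rest? : Decidable 𝒞 → ∀ t → Decidable (Rest 𝒞 t)
Rest? 𝒞? t C = 𝒞? C ×-dec ¬? (HasTD? 𝒞? C t)

Rest-smaller : (𝒞? : Decidable 𝒞) → ∀ {t} → TDmin 𝒞 t → #[ Rest? 𝒞? t ] < #[ 𝒞? ]
Rest-smaller 𝒞? ((_ , c₀ , td₀) , _) = #-strict (Rest? 𝒞? _) 𝒞? proj₁ c₀ λ r → proj₂ r td₀

Rest-inhabited : (𝒞? : Decidable 𝒞) → ∀ {t} → ¬ (∀ C → 𝒞 C → HasTD 𝒞 C t) → ∃ (Rest 𝒞 t)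
Rest-inhabited 𝒞? {t} ¬all-min = decidable-stable (anySubset? (Rest? 𝒞? t)) λ ∄ →
  ¬all-min λ C c → decidable-stable (HasTD? 𝒞? C t) λ ¬td → ∄ (C , c , ¬td)

RTD-from-TDmin : ∀ {n} {𝒞 : ConceptClass n} (𝒞? : Decidable 𝒞) → ∀ {t} → TDmin 𝒞 t →
  (∀ {𝒟 : ConceptClass n} (𝒟? : Decidable 𝒟) → #[ 𝒟? ] < #[ 𝒞? ] → ∃ 𝒟 → ∃ (RTDis 𝒟)) →
  ∃ (RTDis 𝒞)
RTD-from-TDmin 𝒞? {t} tdmin smaller-RTD with universal? anySubset? (λ C → 𝒞? C →-dec HasTD? 𝒞? C t)
... | yes all-min = t , done tdmin all-min
... | no ¬all-min with smaller-RTD (Rest? 𝒞? t) (Rest-smaller 𝒞? tdmin) (Rest-inhabited 𝒞? ¬all-min)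
...   | d , rtd = t ⊔ d , step tdmin ¬all-min rtd

opaque
  RTD-exists : Decidable 𝒞 → ∃ 𝒞 → ∃ (RTDis 𝒞)
  RTD-exists {n} 𝒞? = <-rec Motive go _ 𝒞? refl
    where
    Motive : ℕ → Set₁
    Motive k = ∀ {𝒟 : ConceptClass n} (𝒟? : Decidable 𝒟) → #[ 𝒟? ] ≡ k → ∃ 𝒟 → ∃ (RTDis 𝒟)
    go : ∀ k → (∀ {j} → j < k → Motive j) → Motive k
    go _ below 𝒟? refl inhabited =
      RTD-from-TDmin 𝒟? (proj₂ (TDmin-exists 𝒟? inhabited)) λ ℰ? smaller → below smaller ℰ? refl

toggle : Subset n → Fin n → Subset n
toggle Q x = Q [ x ]%= Bool.not

toggle-≢ : ∀ (Q : Subset n) x → toggle Q x ≢ Q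
toggle-≢ Q x eq = not-¬ refl (trans (sym (cong (λ Q' → lookup Q' x) eq)) (lookup∘updateAt x Q))

toggle-distinguishes-only : ∀ (Q : Subset n) x {y} → Distinguishes y Q (toggle Q x) → y ≡ x
toggle-distinguishes-only Q x {y} d with y ≟ x
... | yes y≡x = y≡x
... | no y≢x with lookup∘updateAt′ y x {Bool.not} y≢x Q | d
...   | same | inj₁ (y∈Q , y∉Q') = contradiction (lookup⇒[]= y _ (trans same ([]=⇒lookup y∈Q))) y∉Q'
...   | same | inj₂ (y∉Q , y∈Q') = contradiction (lookup⇒[]= y Q (trans (sym same) ([]=⇒lookup y∈Q'))) y∉Q

FlipClosed : ConceptClass n → Subset n → Set
FlipClosed 𝒬 L = ∀ Q x → 𝒬 Q → x ∈ L → 𝒬 (toggle Q x)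

module _ (𝒬⊆𝒞 : ∀ {Q} → 𝒬 Q → 𝒞 Q) (flip-closed : FlipClosed 𝒬 L) where

  teaching-set-⊇ : ∀ {Q} → 𝒬 Q → Teaches 𝒞 Q D → L ⊆ D
  teaching-set-⊇ {Q = Q} q D-teaches {x} x∈L
    with D-teaches (toggle Q x) (𝒬⊆𝒞 (flip-closed Q x q x∈L)) (toggle-≢ Q x)
  ... | y , y∈D , d = subst (_∈ _) (toggle-distinguishes-only Q x d) y∈D

  TD-≥ : ∀ {Q t} → 𝒬 Q → HasTD 𝒞 Q t → ∣ L ∣ ≤ t
  TD-≥ q ((D , D-teaches , refl) , _) = p⊆q⇒∣p∣≤∣q∣ (teaching-set-⊇ q D-teaches)

RTD-≥ : ∀ {d} → RTDis 𝒞 d → (∀ {Q} → 𝒬 Q → 𝒞 Q) → FlipClosed 𝒬 L → ∃ 𝒬 → ∣ L ∣ ≤ d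
RTD-≥ (done _ all-min) 𝒬⊆𝒞 flip-closed (_ , q) =
  TD-≥ 𝒬⊆𝒞 flip-closed q (all-min _ (𝒬⊆𝒞 q))
RTD-≥ {𝒞 = 𝒞} {𝒬 = 𝒬} {L = L} (step {t = t} {d = d} _ _ rtd) 𝒬⊆𝒞 flip-closed inhabited with ∣ L ∣ ℕ.≤? t
... | yes ∣L∣≤t = m≤n⇒m≤n⊔o d ∣L∣≤t
... | no ∣L∣≰t = m≤n⇒m≤o⊔n t (RTD-≥ rtd 𝒬⊆Rest flip-closed inhabited)
  where
  𝒬⊆Rest : ∀ {Q} → 𝒬 Q → Rest 𝒞 t Q
  𝒬⊆Rest q = 𝒬⊆𝒞 q , λ td → ∣L∣≰t (TD-≥ 𝒬⊆𝒞 flip-closed q td)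

TeachableWithin : ConceptClass n → ℕ → Set₁
TeachableWithin 𝒞 k =
  ∀ {𝒮} → Decidable 𝒮 → (∀ {C} → 𝒮 C → 𝒞 C) → ∃ 𝒮 →
    ∃ λ C → 𝒮 C × ∃ λ D → Teaches 𝒮 C D × ∣ D ∣ ≤ k

TDmin-≤ : ∀ {t k} → TDmin 𝒞 t → Decidable 𝒞 → TeachableWithin 𝒞 k → t ≤ k
TDmin-≤ ((_ , c₀ , _) , minimal) 𝒞? teachable with teachable 𝒞? id (_ , c₀)
... | C , c , D , D-teaches , ∣D∣≤k with HasTD-exists 𝒞? C
... | _ , td = ≤-trans (minimal C _ c td) (≤-trans (proj₂ td D D-teaches) ∣D∣≤k)

RTD-≤ : ∀ {d k} → RTDis 𝒞 d → Decidable 𝒞 → TeachableWithin 𝒞 k → d ≤ k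
RTD-≤ (done tdmin _) 𝒞? teachable = TDmin-≤ tdmin 𝒞? teachable
RTD-≤ (step {t = t} tdmin _ rtd) 𝒞? teachable =
  ⊔-lub (TDmin-≤ tdmin 𝒞? teachable)
        (RTD-≤ rtd (Rest? 𝒞? t) λ 𝒮? 𝒮⊆Rest → teachable 𝒮? (proj₁ ∘ 𝒮⊆Rest))

-- Walks

private variable
  G H T T* : Graph n
  X Y : Subset n
  u v w a b : Fin n

_⊆ᴱ_ : Graph n → Graph n → Set
G ⊆ᴱ H = ∀ u v → Edge G u v → Edge H u v

Edge-sym : ∀ (G : Graph n) {u v} → Edge G u v → Edge G v u
Edge-sym G {u} {v} e = trans (adj-sym G v u) e

Edge-irrefl : ∀ (G : Graph n) {u v} → Edge G u v → u ≢ v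
Edge-irrefl G {u} e refl = contradiction (trans (sym (irrefl G u)) e) λ ()

edge? : ∀ (G : Graph n) u v → Dec (Edge G u v)
edge? G u v = adj G u v Bool.≟ true

walk-start∈ : PathIn G X u w → u ∈ X
walk-start∈ (here u∈X)     = u∈X
walk-start∈ (step u∈X _ _) = u∈X

walk-end∈ : PathIn G X u w → w ∈ X
walk-end∈ (here w∈X)   = w∈X
walk-end∈ (step _ _ p) = walk-end∈ p

walk-map : G ⊆ᴱ H → X ⊆ Y → PathIn G X u w → PathIn H Y u w
walk-map G⊆H X⊆Y (here u∈X)     = here (X⊆Y u∈X)
walk-map G⊆H X⊆Y (step u∈X e p) = step (X⊆Y u∈X) (G⊆H _ _ e) (walk-map G⊆H X⊆Y p)

walk-⊆ : X ⊆ Y → PathIn G X u w → PathIn G Y u w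
walk-⊆ = walk-map λ _ _ → id

infixr 5 _++ʷ_

_++ʷ_ : PathIn G X u v → PathIn G X v w → PathIn G X u w
here _       ++ʷ q = q
step u∈X e p ++ʷ q = step u∈X e (p ++ʷ q)

walk-snoc : PathIn G X u v → Edge G v w → w ∈ X → PathIn G X u w
walk-snoc p e w∈X = p ++ʷ step (walk-end∈ p) e (here w∈X)

walk-reverse : PathIn G X u w → PathIn G X w u
walk-reverse (here u∈X)     = here u∈X
walk-reverse {G = G} (step u∈X e p) = walk-snoc (walk-reverse p) (Edge-sym G e) u∈X

walk-closed : (∀ {a b} → Edge G a b → a ∈ Y → b ∈ Y) → u ∈ Y → PathIn G X u w → PathIn G Y u w
walk-closed closed u∈Y (here _)     = here u∈Y
walk-closed closed u∈Y (step _ e p) = step u∈Y e (walk-closed closed (closed e u∈Y) p)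

crossing-edge : ∀ Y → PathIn G X u w → u ∈ Y → w ∉ Y →
  ∃ λ a → ∃ λ b → a ∈ Y × b ∉ Y × Edge G a b × a ∈ X × b ∈ X
crossing-edge Y (here _) u∈Y w∉Y = contradiction u∈Y w∉Y
crossing-edge Y (step {v = v} u∈X e p) u∈Y w∉Y with v ∈? Y
... | yes v∈Y = crossing-edge Y p v∈Y w∉Y
... | no v∉Y = _ , v , u∈Y , v∉Y , e , u∈X , walk-start∈ p

last-exit : ∀ u → u ≢ w → PathIn G X a w →
  PathIn G (X - u) a w ⊎ ∃ λ v → Edge G u v × PathIn G (X - u) v w
last-exit u u≢w (here w∈X) = inj₁ (here (x∈p∧x≢y⇒x∈p-y w∈X (u≢w ∘ sym)))
last-exit {a = a} u u≢w (step {v = b} a∈X e p) with last-exit u u≢w p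
... | inj₂ exit = inj₂ exit
... | inj₁ q with a ≟ u
...   | yes refl = inj₂ (b , e , q)
...   | no a≢u = inj₁ (step (x∈p∧x≢y⇒x∈p-y a∈X a≢u) e q)

walk? : ∀ (G : Graph n) X u w → Dec (PathIn G X u w)
walk? G = ⊂-rec (λ X → ∀ u w → Dec (PathIn G X u w)) go
  where
  go : ∀ X → (∀ {Y} → Y ⊂ X → ∀ u w → Dec (PathIn G Y u w)) → ∀ u w → Dec (PathIn G X u w)
  go X smaller u w with u ∈? X | u ≟ w
  ... | no u∉X  | _        = no (u∉X ∘ walk-start∈)
  ... | yes u∈X | yes refl = yes (here u∈X)
  ... | yes u∈X | no u≢w
    with any? (λ v → edge? G u v ×-dec smaller (x∈p⇒p-x⊂p u∈X) v w)
  ...   | yes (v , e , q) = yes (step u∈X e (walk-⊆ (x∈p-y⇒x∈p {p = X}) q))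
  ...   | no ∄ = no λ p → [ (λ q → x∈p-y⇒x≢y {p = X} (walk-start∈ q) refl) , ∄ ]′ (last-exit u u≢w p)

connected? : ∀ (G : Graph n) X → Dec (ConnectedSet G X)
connected? G X = nonempty? X ×-dec
  all? λ u → all? λ v → (u ∈? X) →-dec ((v ∈? X) →-dec walk? G X u v)

Ccon? : ∀ (G : Graph n) → Decidable (Ccon G)
Ccon? G C = (C ≟ˢ Empty) ⊎-dec connected? G C

-- Simple walks and cycles

_∈ʷ_ : ∀ {n} {G : Graph n} {X u w} → Fin n → PathIn G X u w → Set
x ∈ʷ here {u} _     = x ≡ u
x ∈ʷ step {u} _ _ p = x ≡ u ⊎ x ∈ʷ p

Simple : PathIn G X u w → Set
Simple (here _)         = ⊤
Simple (step {u} _ _ p) = ¬ u ∈ʷ p × Simple p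

length : PathIn G X u w → ℕ
length (here _)     = 0
length (step _ _ p) = suc (length p)

_∈ʷ?_ : ∀ x (p : PathIn G X u w) → Dec (x ∈ʷ p)
x ∈ʷ? here {u} _     = x ≟ u
x ∈ʷ? step {u} _ _ p = (x ≟ u) ⊎-dec (x ∈ʷ? p)

∈ʷ⇒∈ : ∀ (p : PathIn G X u w) → x ∈ʷ p → x ∈ X
∈ʷ⇒∈ (here u∈X)     refl        = u∈X
∈ʷ⇒∈ (step u∈X _ p) (inj₁ refl) = u∈X
∈ʷ⇒∈ (step _ _ p)   (inj₂ x∈p)  = ∈ʷ⇒∈ p x∈p

end-∈ʷ : ∀ (p : PathIn G X u w) → w ∈ʷ p
end-∈ʷ (here _)     = refl
end-∈ʷ (step _ _ p) = inj₂ (end-∈ʷ p)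

vertex : ∀ {n} {G : Graph n} {X u w} (p : PathIn G X u w) → Fin (suc (length p)) → Fin n
vertex (here {u} _)     zero    = u
vertex (step {u} _ _ p) zero    = u
vertex (step _ _ p)     (suc i) = vertex p i

vertex-∈ʷ : ∀ (p : PathIn G X u w) i → vertex p i ∈ʷ p
vertex-∈ʷ (here _)     zero    = refl
vertex-∈ʷ (step _ _ p) zero    = inj₁ refl
vertex-∈ʷ (step _ _ p) (suc i) = inj₂ (vertex-∈ʷ p i)

vertex-last : ∀ (p : PathIn G X u w) → vertex p (fromℕ (length p)) ≡ w
vertex-last (here _)     = refl
vertex-last (step _ _ p) = vertex-last p

vertex-edge : ∀ (p : PathIn G X u w) i → Edge G (vertex p (inject₁ i)) (vertex p (suc i))
vertex-edge (step _ e (here _))       zero    = e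
vertex-edge (step _ e (step _ _ _))   zero    = e
vertex-edge (step _ _ p@(step _ _ _)) (suc i) = vertex-edge p i

vertex-injective : ∀ (p : PathIn G X u w) → Simple p → Injective _≡_ _≡_ (vertex p)
vertex-injective (here _)     _            {zero}  {zero}  _  = refl
vertex-injective (step _ _ p) _            {zero}  {zero}  _  = refl
vertex-injective (step _ _ p) (u∉p , _)    {zero}  {suc j} eq =
  contradiction (subst (_∈ʷ p) (sym eq) (vertex-∈ʷ p j)) u∉p
vertex-injective (step _ _ p) (u∉p , _)    {suc i} {zero}  eq =
  contradiction (subst (_∈ʷ p) eq (vertex-∈ʷ p i)) u∉p
vertex-injective (step _ _ p) (_ , simple) {suc i} {suc j} eq =
  cong suc (vertex-injective p simple eq)

simple-length< : ∀ {n} {G : Graph n} {X u w} (p : PathIn G X u w) → Simple p → length p < n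
simple-length< p simple = injective⇒≤ (vertex-injective p simple)

module _ {n} {G H : Graph n} {X Y : Subset n} (G⊆H : G ⊆ᴱ H) (X⊆Y : X ⊆ Y) where

  ∈ʷ-walk-map⁻ : ∀ (p : PathIn G X u w) → x ∈ʷ walk-map {H = H} G⊆H X⊆Y p → x ∈ʷ p
  ∈ʷ-walk-map⁻ (here _)     x∈p        = x∈p
  ∈ʷ-walk-map⁻ (step _ _ p) (inj₁ x≡u) = inj₁ x≡u
  ∈ʷ-walk-map⁻ (step _ _ p) (inj₂ x∈p) = inj₂ (∈ʷ-walk-map⁻ p x∈p)

  Simple-walk-map : ∀ (p : PathIn G X u w) → Simple p → Simple (walk-map {H = H} G⊆H X⊆Y p)
  Simple-walk-map (here _)     _             = tt
  Simple-walk-map (step _ _ p) (u∉p , simple) = u∉p ∘ ∈ʷ-walk-map⁻ p , Simple-walk-map p simple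

  length-walk-map : ∀ (p : PathIn G X u w) → length (walk-map {H = H} G⊆H X⊆Y p) ≡ length p
  length-walk-map (here _)     = refl
  length-walk-map (step _ _ p) = cong suc (length-walk-map p)

suffix-from : ∀ (p : PathIn G X u w) → x ∈ʷ p →
  ∃ λ (q : PathIn G X x w) → (Simple p → Simple q) × (∀ {y} → y ∈ʷ q → y ∈ʷ p)
suffix-from p@(here _)     refl        = p , id , id
suffix-from p@(step _ _ _) (inj₁ refl) = p , id , id
suffix-from (step _ _ p)   (inj₂ x∈p) with suffix-from p x∈p
... | q , simple , q⊆p = q , simple ∘ proj₂ , inj₂ ∘ q⊆p

prefix-to : ∀ (p : PathIn G X u w) → x ∈ʷ p →
  ∃ λ (q : PathIn G X u x) → (Simple p → Simple q) × (∀ {y} → y ∈ʷ q → y ∈ʷ p)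
prefix-to p@(here _)     refl        = p , id , id
prefix-to (step u∈X _ _) (inj₁ refl) = here u∈X , (λ _ → tt) , inj₁
prefix-to (step u∈X e p) (inj₂ x∈p) with prefix-to p x∈p
... | q , simple , q⊆p =
  step u∈X e q , (λ (u∉p , s) → u∉p ∘ q⊆p , simple s) , [ inj₁ , inj₂ ∘ q⊆p ]′

shortcut : ∀ (p : PathIn G X u w) → ∃ λ (q : PathIn G X u w) → Simple q × (∀ {y} → y ∈ʷ q → y ∈ʷ p)
shortcut p@(here _) = p , tt , id
shortcut {u = u} (step u∈X e p) with shortcut p
... | q , simple , q⊆p with u ∈ʷ? q
...   | yes u∈q = let r , simple-r , r⊆q = suffix-from q u∈q in r , simple-r simple , inj₂ ∘ q⊆p ∘ r⊆q
...   | no u∉q  = step u∈X e q , (u∉q , simple) , [ inj₁ , inj₂ ∘ q⊆p ]′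

module _ (acyclic : Acyclic G) where

  no-closing-edge : ∀ (p : PathIn G X a b) → Simple p → 2 ≤ length p → ¬ Edge G b a
  no-closing-edge p@(step _ _ (step _ _ _)) simple _ e =
    acyclic _ (vertex p) (vertex-injective p simple) (vertex-edge p)
            (subst₂ (Edge G) (sym (vertex-last p)) refl e)
  no-closing-edge (step _ _ (here _)) _ (s≤s ())

  no-apex : ∀ (p : PathIn G X a b) → Simple p → ¬ x ∈ʷ p → a ≢ b → Edge G x a → ¬ Edge G b x
  no-apex p@(step _ _ _) simple x∉p _ e-xa =
    no-closing-edge (step ∈⊤ e-xa (walk-map G⊆G X⊆Full p))
      (x∉p ∘ ∈ʷ-walk-map⁻ G⊆G X⊆Full p , Simple-walk-map G⊆G X⊆Full p simple)
      (s≤s (subst (1 ≤_) (sym (length-walk-map G⊆G X⊆Full p)) (s≤s z≤n)))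
    where
    G⊆G : G ⊆ᴱ G
    G⊆G _ _ = id
    X⊆Full : X ⊆ Full
    X⊆Full _ = ∈⊤
  no-apex (here _) _ _ a≢a = contradiction refl a≢a

  no-chord-back : ∀ {s} (u∈X : u ∈ X) (e : Edge G u s) (p : PathIn G X s b) →
    Simple (step u∈X e p) → x ∈ʷ p → x ≢ s → ¬ Edge G x u
  no-chord-back u∈X e p (u∉p , simple) x∈p x≢s with prefix-to p x∈p
  ... | q@(step _ _ _) , simple-q , q⊆p =
    no-closing-edge (step u∈X e q) (u∉p ∘ q⊆p , simple-q simple) (s≤s (s≤s z≤n))
  ... | here _ , _ , _ = contradiction refl x≢s

last-or-inject₁ : ∀ {m} (j : Fin (suc m)) → j ≡ fromℕ m ⊎ ∃ λ i → j ≡ inject₁ i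
last-or-inject₁ {zero}  zero    = inj₁ refl
last-or-inject₁ {suc m} zero    = inj₂ (zero , refl)
last-or-inject₁ {suc m} (suc j) with last-or-inject₁ j
... | inj₁ refl       = inj₁ refl
... | inj₂ (i , refl) = inj₂ (suc i , refl)

module _ (G : Graph n) {k} (c : Fin (suc (suc (suc k))) → Fin n)
         (path : ∀ i → Edge G (c (inject₁ i)) (c (suc i)))
         (closing : Edge G (c (fromℕ (suc (suc k)))) (c zero)) where

  cycle-two-neighbours : ∀ j → ∃ λ j₁ → ∃ λ j₂ → j₁ ≢ j₂ × Edge G (c j) (c j₁) × Edge G (c j) (c j₂)
  cycle-two-neighbours zero = suc zero , fromℕ (suc (suc k)) , (λ ()) , path zero , Edge-sym G closing
  cycle-two-neighbours (suc i) with last-or-inject₁ (suc i)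
  ... | inj₁ i+1≡last =
    inject₁ i , zero , inject₁-last≢0 (suc-injective i+1≡last) , Edge-sym G (path i) ,
    subst (λ j → Edge G (c j) (c zero)) (sym i+1≡last) closing
    where
    inject₁-last≢0 : ∀ {i} → i ≡ fromℕ (suc k) → inject₁ i ≢ zero
    inject₁-last≢0 refl ()
  ... | inj₂ (i′ , i+1≡i′) =
    inject₁ i , suc i′ , inject₁≢suc , Edge-sym G (path i) ,
    subst (λ j → Edge G (c j) (c (suc i′))) (sym i+1≡i′) (path i′)
    where
    inject₁≢suc : inject₁ i ≢ suc i′
    inject₁≢suc eq = <⇒≢ (m<n⇒m<1+n (n<1+n (toℕ i′))) (begin
      toℕ i′               ≡⟨ toℕ-inject₁ i′ ⟨
      toℕ (inject₁ i′)     ≡⟨ cong toℕ i+1≡i′ ⟨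
      suc (toℕ i)          ≡⟨ cong suc (toℕ-inject₁ i) ⟨
      suc (toℕ (inject₁ i)) ≡⟨ cong (suc ∘ toℕ) eq ⟩
      suc (suc (toℕ i′))   ∎)
      where open ≡-Reasoning

AtMostOneNeighbour : Graph n → Fin n → Set
AtMostOneNeighbour G a = ∀ {x y} → Edge G a x → Edge G a y → x ≡ y

Acyclic-sub : H ⊆ᴱ G → Acyclic G → Acyclic H
Acyclic-sub H⊆G acyclic k c injective path closing = acyclic k c injective (H⊆G _ _ ∘ path) (H⊆G _ _ closing)

Acyclic-extend : Acyclic G →
  (∀ {a b} → Edge H a b → Edge G a b ⊎ AtMostOneNeighbour H a ⊎ AtMostOneNeighbour H b) → Acyclic H
Acyclic-extend {G = G} {H = H} acyclic H⇒G k c injective path closing =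
  acyclic k c injective (cycle-edge ∘ path) (cycle-edge closing)
  where
  branching : ∀ j → ¬ AtMostOneNeighbour H (c j)
  branching j unique with cycle-two-neighbours H c path closing j
  ... | _ , _ , j₁≢j₂ , e₁ , e₂ = j₁≢j₂ (injective (unique e₁ e₂))
  cycle-edge : ∀ {i j} → Edge H (c i) (c j) → Edge G (c i) (c j)
  cycle-edge {i} {j} e with H⇒G e
  ... | inj₁ e′ = e′
  ... | inj₂ (inj₁ unique) = ⊥-elim (branching i unique)
  ... | inj₂ (inj₂ unique) = ⊥-elim (branching j unique)

-- Graphs from decidable relations; degrees and leaves

graphOf : {R : Fin n → Fin n → Set} → (∀ a b → Dec (R a b)) → Graph n
graphOf {n} {R} R? = record
  { adj    = λ a b → does (link? a b)
  ; sym    = λ a b → does-⇔ (mk⇔ swap-link swap-link) (link? a b) (link? b a)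
  ; irrefl = λ a → dec-false (link? a a) λ (_ , a≢a) → a≢a refl
  }
  where
  Link : Fin n → Fin n → Set
  Link a b = (R a b ⊎ R b a) × a ≢ b
  link? : ∀ a b → Dec (Link a b)
  link? a b = (R? a b ⊎-dec R? b a) ×-dec ¬? (a ≟ b)
  swap-link : ∀ {a b} → Link a b → Link b a
  swap-link (r , a≢b) = Sum.swap r , a≢b ∘ sym

module _ {R : Fin n → Fin n → Set} (R? : ∀ a b → Dec (R a b)) where

  Edge-graphOf⁺ : R a b ⊎ R b a → a ≢ b → Edge (graphOf R?) a b
  Edge-graphOf⁺ {a = a} {b = b} r a≢b = dec-true ((R? a b ⊎-dec R? b a) ×-dec ¬? (a ≟ b)) (r , a≢b)

  Edge-graphOf⁻ : Edge (graphOf R?) a b → R a b ⊎ R b a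
  Edge-graphOf⁻ {a = a} {b = b} e = proj₁ (does-true⇒ ((R? a b ⊎-dec R? b a) ×-dec ¬? (a ≟ b)) e)

nbhd : Graph n → Fin n → Subset n
nbhd G v = tabulate (adj G v)

leafSet : Graph n → Subset n
leafSet G = tabulate (λ v → degree G v ℕ.≡ᵇ 1)

∈leafSet⁺ : ∀ (G : Graph n) {v} → degree G v ≡ 1 → v ∈ leafSet G
∈leafSet⁺ G {v} deg≡1 = ∈-tabulate⁺ _ (T-≡ .Equivalence.to (≡⇒≡ᵇ (degree G v) 1 deg≡1))

∈leafSet⁻ : ∀ (G : Graph n) {v} → v ∈ leafSet G → degree G v ≡ 1
∈leafSet⁻ G {v} v∈ = ≡ᵇ⇒≡ (degree G v) 1 (T-≡ .Equivalence.from (∈-tabulate⁻ _ v∈))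

Edge⇒0<degree : ∀ (G : Graph n) {v a} → Edge G v a → 0 < degree G v
Edge⇒0<degree G {v} e = x∈p⇒0<∣p∣ (∈-tabulate⁺ (adj G v) e)

degree≡1⇒neighbour : ∀ (G : Graph n) {v} → degree G v ≡ 1 → ∃ (Edge G v)
degree≡1⇒neighbour G {v} deg≡1 with 0<∣p∣⇒Nonempty {p = nbhd G v} (≤-reflexive (sym deg≡1))
... | a , a∈ = a , ∈-tabulate⁻ _ a∈

degree≤1⇒unique : ∀ (G : Graph n) → degree G v ≤ 1 → AtMostOneNeighbour G v
degree≤1⇒unique G deg≤1 {x} {y} e-x e-y with x ≟ y
... | yes x≡y = x≡y
... | no x≢y = contradiction deg≤1 (<⇒≱ (distinct⇒2≤∣p∣ (∈-tabulate⁺ _ e-x) (∈-tabulate⁺ _ e-y) x≢y))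

unique⇒degree≤1 : ∀ (G : Graph n) {v} → AtMostOneNeighbour G v → degree G v ≤ 1
unique⇒degree≤1 G {v} unique with degree G v ℕ.≤? 1
... | yes deg≤1 = deg≤1
... | no deg≰1 with 2≤∣p∣⇒distinct {p = nbhd G v} (≰⇒> deg≰1)
...   | x , y , x∈ , y∈ , x≢y = contradiction (unique (∈-tabulate⁻ _ x∈) (∈-tabulate⁻ _ y∈)) x≢y

degree≡1⁺ : ∀ (G : Graph n) → Edge G v a → AtMostOneNeighbour G v → degree G v ≡ 1
degree≡1⁺ G e unique = ≤-antisym (unique⇒degree≤1 G unique) (Edge⇒0<degree G e)

record SameEdges (G H : Graph n) : Set where
  constructor sameEdges
  field
    forth : G ⊆ᴱ H
    back  : H ⊆ᴱ G

SameEdges⇒leaves≡ : SameEdges G H → leaves G ≡ leaves H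
SameEdges⇒leaves≡ {G = G} {H = H} (sameEdges G⊆H H⊆G) =
  cong ∣_∣ (tabulate-cong λ v → cong (ℕ._≡ᵇ 1) (cong ∣_∣ (tabulate-cong (same-adj v))))
  where
  same-adj : ∀ u v → adj G u v ≡ adj H u v
  same-adj u v with adj G u v in eG | adj H u v in eH
  ... | true  | true  = refl
  ... | false | false = refl
  ... | true  | false = contradiction (trans (sym eH) (G⊆H u v eG)) λ ()
  ... | false | true  = contradiction (trans (sym eG) (H⊆G u v eH)) λ ()

-- Spanning trees

emptyGraph : Graph n
emptyGraph = graphOf {R = λ _ _ → ⊥} λ _ _ → no id

emptyGraph-no-edge : ∀ (u v : Fin n) → ¬ Edge emptyGraph u v
emptyGraph-no-edge u v e with Edge-graphOf⁻ {R = λ _ _ → ⊥} (λ _ _ → no id) {a = u} {b = v} e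
... | inj₁ ()
... | inj₂ ()

singleton-tree : ∀ (H : Graph n) x → SpanningTreeOn H ⁅ x ⁆ emptyGraph
singleton-tree H x =
  (λ a b e → ⊥-elim (emptyGraph-no-edge a b e)) , (λ a b e → ⊥-elim (emptyGraph-no-edge a b e)) ,
  ((x , x∈⁅x⁆ x) , λ u v u∈ v∈ →
     subst (PathIn _ _ u) (trans (x∈⁅y⁆⇒x≡y x u∈) (sym (x∈⁅y⁆⇒x≡y x v∈))) (here u∈)) ,
  λ k c _ _ closing → emptyGraph-no-edge (c (fromℕ (suc (suc k)))) (c zero) closing

module GrowthStep {H T : Graph n} {Y : Subset n} (tree : SpanningTreeOn H Y T)
                  {u w} (u∈Y : u ∈ Y) (w∉Y : w ∉ Y) (e : Edge H u w) where

  private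
    NewEdge : Fin n → Fin n → Set
    NewEdge a b = Edge T a b ⊎ (a ≡ u × b ≡ w)

    NewEdge? : ∀ a b → Dec (NewEdge a b)
    NewEdge? a b = edge? T a b ⊎-dec ((a ≟ u) ×-dec (b ≟ w))

    u≢w : u ≢ w
    u≢w refl = w∉Y u∈Y

  T′ : Graph n
  T′ = graphOf NewEdge?

  Y′ : Subset n
  Y′ = Y ∪ ⁅ w ⁆

  T⊆T′ : T ⊆ᴱ T′
  T⊆T′ _ _ e = Edge-graphOf⁺ NewEdge? (inj₁ (inj₁ e)) (Edge-irrefl T e)

  new-edge : Edge T′ u w
  new-edge = Edge-graphOf⁺ NewEdge? (inj₁ (inj₂ (refl , refl))) u≢w

  T′-edge : Edge T′ a b → Edge T a b ⊎ (a ≡ u × b ≡ w) ⊎ (a ≡ w × b ≡ u)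
  T′-edge e′ with Edge-graphOf⁻ NewEdge? e′
  ... | inj₁ (inj₁ e) = inj₁ e
  ... | inj₂ (inj₁ e) = inj₁ (Edge-sym T e)
  ... | inj₁ (inj₂ a≡u×b≡w) = inj₂ (inj₁ a≡u×b≡w)
  ... | inj₂ (inj₂ (b≡u , a≡w)) = inj₂ (inj₂ (a≡w , b≡u))

  w-isolated : ¬ Edge T w b
  w-isolated e = w∉Y (proj₁ (proj₂ tree) _ _ e)

  w-pendant : AtMostOneNeighbour T′ w
  w-pendant {x} {y} e-x e-y = trans (only-u e-x) (sym (only-u e-y))
    where
    only-u : ∀ {b} → Edge T′ w b → b ≡ u
    only-u e′ with T′-edge e′
    ... | inj₁ e = contradiction e w-isolated
    ... | inj₂ (inj₁ (w≡u , _)) = contradiction (sym w≡u) u≢w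
    ... | inj₂ (inj₂ (_ , b≡u)) = b≡u

  degree-w : degree T′ w ≡ 1
  degree-w = degree≡1⁺ T′ (Edge-sym T′ new-edge) w-pendant

  tree′ : SpanningTreeOn H Y′ T′
  tree′ = T′⊆H , T′-inside , (Y′-nonempty , T′-walk) , T′-acyclic
    where
    T⊆H = proj₁ tree
    T-inside = proj₁ (proj₂ tree)
    T-connected = proj₁ (proj₂ (proj₂ tree))
    T-acyclic = proj₂ (proj₂ (proj₂ tree))
    Y⊆Y′ : Y ⊆ Y′
    Y⊆Y′ = p⊆p∪q ⁅ w ⁆
    w∈Y′ : w ∈ Y′
    w∈Y′ = x∈p∪q⁺ (inj₂ (x∈⁅x⁆ w))
    T′⊆H : T′ ⊆ᴱ H
    T′⊆H a b e′ with T′-edge e′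
    ... | inj₁ e-T = T⊆H a b e-T
    ... | inj₂ (inj₁ (refl , refl)) = e
    ... | inj₂ (inj₂ (refl , refl)) = Edge-sym H e
    T′-inside : ∀ a b → Edge T′ a b → a ∈ Y′
    T′-inside a b e′ with T′-edge e′
    ... | inj₁ e-T = Y⊆Y′ (T-inside a b e-T)
    ... | inj₂ (inj₁ (refl , _)) = Y⊆Y′ u∈Y
    ... | inj₂ (inj₂ (refl , _)) = w∈Y′
    Y′-nonempty : Nonempty Y′
    Y′-nonempty = w , w∈Y′
    lift : PathIn T Y a b → PathIn T′ Y′ a b
    lift = walk-map T⊆T′ Y⊆Y′
    T′-walk : ∀ a b → a ∈ Y′ → b ∈ Y′ → PathIn T′ Y′ a b
    T′-walk a b a∈ b∈ with x∈p∪q⁻ Y ⁅ w ⁆ a∈ | x∈p∪q⁻ Y ⁅ w ⁆ b∈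
    ... | inj₁ a∈Y | inj₁ b∈Y = lift (proj₂ T-connected a b a∈Y b∈Y)
    ... | inj₁ a∈Y | inj₂ b∈w rewrite x∈⁅y⁆⇒x≡y w b∈w =
      walk-snoc (lift (proj₂ T-connected a u a∈Y u∈Y)) new-edge w∈Y′
    ... | inj₂ a∈w | inj₁ b∈Y rewrite x∈⁅y⁆⇒x≡y w a∈w =
      step w∈Y′ (Edge-sym T′ new-edge) (lift (proj₂ T-connected u b u∈Y b∈Y))
    ... | inj₂ a∈w | inj₂ b∈w rewrite x∈⁅y⁆⇒x≡y w a∈w | x∈⁅y⁆⇒x≡y w b∈w = here w∈Y′
    T′-acyclic : Acyclic T′
    T′-acyclic = Acyclic-extend {G = T} {H = T′} T-acyclic λ e′ → Sum.map₂ pendant (T′-edge e′)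
      where
      pendant : ∀ {a b} → (a ≡ u × b ≡ w) ⊎ (a ≡ w × b ≡ u) →
                AtMostOneNeighbour T′ a ⊎ AtMostOneNeighbour T′ b
      pendant (inj₁ (_ , refl)) = inj₂ w-pendant
      pendant (inj₂ (refl , _)) = inj₁ w-pendant

  leaves-mono : leaves T ≤ leaves T′
  leaves-mono = ≤-trans (∣p∣≤1+∣p-x∣ (leafSet T) u)
                        (p⊂q⇒∣p∣<∣q∣ (L-u⊆L′ , w , ∈leafSet⁺ T′ degree-w , w∉L-u))
    where
    w-not-leaf : w ∉ leafSet T
    w-not-leaf w∈L = w-isolated (proj₂ (degree≡1⇒neighbour T (∈leafSet⁻ T w∈L)))
    same-nbhd : ∀ {y} → y ≢ u → y ≢ w → nbhd T′ y ≡ nbhd T y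
    same-nbhd {y} y≢u y≢w = ⊆-antisym T′⊆T (λ z∈ → ∈-tabulate⁺ _ (T⊆T′ _ _ (∈-tabulate⁻ _ z∈)))
      where
      T′⊆T : nbhd T′ y ⊆ nbhd T y
      T′⊆T z∈ with T′-edge (∈-tabulate⁻ (adj T′ y) z∈)
      ... | inj₁ e-T = ∈-tabulate⁺ _ e-T
      ... | inj₂ (inj₁ (y≡u , _)) = contradiction y≡u y≢u
      ... | inj₂ (inj₂ (y≡w , _)) = contradiction y≡w y≢w
    L-u⊆L′ : leafSet T - u ⊆ leafSet T′
    L-u⊆L′ {y} y∈ = ∈leafSet⁺ T′ (trans (cong ∣_∣ (same-nbhd y≢u y≢w)) (∈leafSet⁻ T y∈L))
      where
      y∈L = x∈p-y⇒x∈p {p = leafSet T} y∈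
      y≢u = x∈p-y⇒x≢y {p = leafSet T} y∈
      y≢w : y ≢ w
      y≢w refl = w-not-leaf y∈L
    w∉L-u : w ∉ leafSet T - u
    w∉L-u = w-not-leaf ∘ x∈p-y⇒x∈p {p = leafSet T}

Extends : Graph n → Subset n → Graph n → Graph n → Set
Extends H X T T* = SpanningTreeOn H X T* × T ⊆ᴱ T* × leaves T ≤ leaves T*

grow : ConnectedSet H X → Y ⊆ X → SpanningTreeOn H Y T → ∃ (Extends H X T)
grow {H = H} {X = X} {Y = Y₀} (_ , H-walk) =
  ⊃-rec (λ Y → ∀ {T} → Y ⊆ X → SpanningTreeOn H Y T → ∃ (Extends H X T)) go Y₀
  where
  go : ∀ Y → (∀ {Y′} → Y ⊂ Y′ → ∀ {T} → Y′ ⊆ X → SpanningTreeOn H Y′ T → ∃ (Extends H X T)) →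
       ∀ {T} → Y ⊆ X → SpanningTreeOn H Y T → ∃ (Extends H X T)
  go Y larger {T} Y⊆X tree@(T⊆H , T-inside , ((y₀ , y₀∈Y) , T-walk) , T-acyclic)
    with any? (λ u → any? λ w → (u ∈? Y) ×-dec (w ∈? X) ×-dec ¬? (w ∈? Y) ×-dec edge? H u w)
  ... | yes (u , w , u∈Y , w∈X , w∉Y , e) =
    let T* , tree* , T′⊆T* , leaves′≤ = larger Y⊂Y′ Y′⊆X tree′
    in T* , tree* , (λ a b → T′⊆T* a b ∘ T⊆T′ a b) , ≤-trans leaves-mono leaves′≤
    where
    open GrowthStep {H = H} {T = T} tree u∈Y w∉Y e
    Y⊂Y′ : Y ⊂ Y′
    Y⊂Y′ = p⊆p∪q ⁅ w ⁆ , w , x∈p∪q⁺ (inj₂ (x∈⁅x⁆ w)) , w∉Y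
    Y′⊆X : Y′ ⊆ X
    Y′⊆X v∈ = [ Y⊆X , (λ v∈w → subst (_∈ X) (sym (x∈⁅y⁆⇒x≡y w v∈w)) w∈X) ]′ (x∈p∪q⁻ Y ⁅ w ⁆ v∈)
  ... | no ∄crossing =
    T , (T⊆H , (λ a b → Y⊆X ∘ T-inside a b) , ((y₀ , Y⊆X y₀∈Y) , T-walk′) , T-acyclic) , (λ _ _ → id) , ≤-refl
    where
    X⊆Y : X ⊆ Y
    X⊆Y {x} x∈X = decidable-stable (x ∈? Y) λ x∉Y →
      let a , b , a∈Y , b∉Y , e , _ , b∈X = crossing-edge Y (H-walk y₀ x (Y⊆X y₀∈Y) x∈X) y₀∈Y x∉Y
      in ∄crossing (a , b , a∈Y , b∈X , b∉Y , e)
    T-walk′ : ∀ a b → a ∈ X → b ∈ X → PathIn T X a b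
    T-walk′ a b a∈X b∈X = walk-⊆ Y⊆X (T-walk a b (X⊆Y a∈X) (X⊆Y b∈X))

spanning-tree-exists : ConnectedSet H X → ∃ (SpanningTreeOn H X)
spanning-tree-exists {H = H} {X = X} connected@((x₀ , x₀∈X) , _) =
  let T , tree , _ = grow connected x₀⊆X (singleton-tree H x₀) in T , tree
  where
  x₀⊆X : ⁅ x₀ ⁆ ⊆ X
  x₀⊆X x∈ = subst (_∈ X) (sym (x∈⁅y⁆⇒x≡y x₀ x∈)) x₀∈X

leaf-outside : ∀ {T₁ T₂ : Graph n} {C Z} → ConnectedSet T₁ C → T₁ ⊆ᴱ T₂ → C ⊆ Z →
  ConnectedSet T₂ Z → Acyclic T₂ → ∀ {y} → y ∈ Z → y ∉ C → (∀ {z} → Edge T₂ y z → z ∈ C) → degree T₂ y ≡ 1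
leaf-outside {T₂ = T₂} ((c , c∈C) , T₁-walk) T₁⊆T₂ C⊆Z (_ , T₂-walk) T₂-acyclic {y} y∈Z y∉C into-C
  with T₂-walk y c y∈Z (C⊆Z c∈C)
... | here _ = ⊥-elim (y∉C c∈C)
... | step _ e _ = degree≡1⁺ T₂ e unique
  where
  unique : AtMostOneNeighbour T₂ y
  unique {z₁} {z₂} e₁ e₂ = decidable-stable (z₁ ≟ z₂) λ z₁≢z₂ →
    no-apex T₂-acyclic (walk-map T₁⊆T₂ C⊆Z path) (Simple-walk-map {H = T₂} T₁⊆T₂ C⊆Z path simple)
            (λ y∈ → y∉C (∈ʷ⇒∈ path (∈ʷ-walk-map⁻ {H = T₂} T₁⊆T₂ C⊆Z path y∈))) z₁≢z₂ e₁ (Edge-sym T₂ e₂)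
    where
    shortened = shortcut (T₁-walk z₁ z₂ (into-C e₁) (into-C e₂))
    path = proj₁ shortened
    simple = proj₁ (proj₂ shortened)

-- Maximising leaves over connected spanning subgraphs keeps the search decidable (acyclicity is
-- not checked); a spanning tree of a maximiser keeps all its leaves (leaf-preserved).
record ConnectedSpanning (G : Graph n) (X : Subset n) (H : Graph n) : Set where
  constructor connectedSpanning
  field
    ⊆G        : H ⊆ᴱ G
    edges-in  : ∀ u v → Edge H u v → u ∈ X
    connected : ConnectedSet H X

ConnectedSpanning? : ∀ (G : Graph n) X H → Dec (ConnectedSpanning G X H)
ConnectedSpanning? G X H =
  map′ (λ (H⊆G , H-inside , H-connected) → connectedSpanning H⊆G H-inside H-connected)
       (λ (connectedSpanning H⊆G H-inside H-connected) → H⊆G , H-inside , H-connected)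
       ((all? λ u → all? λ v → edge? H u v →-dec edge? G u v) ×-dec
        (all? λ u → all? λ v → edge? H u v →-dec (u ∈? X)) ×-dec
        connected? H X)

ConnectedSpanning-resp : ∀ {H′} → SameEdges H H′ → ConnectedSpanning G X H → ConnectedSpanning G X H′
ConnectedSpanning-resp (sameEdges H⊆H′ H′⊆H) (connectedSpanning H⊆G H-inside (nonempty , H-walk)) =
  connectedSpanning (λ u v → H⊆G u v ∘ H′⊆H u v) (λ u v → H-inside u v ∘ H′⊆H u v)
                    (nonempty , λ a b a∈ b∈ → walk-map H⊆H′ id (H-walk a b a∈ b∈))

SpanningTreeOn⇒ConnectedSpanning : SpanningTreeOn G X T → ConnectedSpanning G X T
SpanningTreeOn⇒ConnectedSpanning (T⊆G , T-inside , T-connected , _) =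
  connectedSpanning T⊆G T-inside T-connected

decode : Vec (Subset n) n → Graph n
decode E = graphOf λ a b → b ∈? lookup E a

encode : Graph n → Vec (Subset n) n
encode H = tabulate (nbhd H)

encode-decode : ∀ (H : Graph n) → SameEdges H (decode (encode H))
encode-decode H = sameEdges H⊆decoded decoded⊆H
  where
  ∈-encode⁻ : ∀ {u v} → v ∈ lookup (encode H) u → Edge H u v
  ∈-encode⁻ {u} v∈ = ∈-tabulate⁻ (adj H u) (subst (_ ∈_) (lookup∘tabulate (nbhd H) u) v∈)
  decoded⊆H : decode (encode H) ⊆ᴱ H
  decoded⊆H u v e with Edge-graphOf⁻ (λ a b → b ∈? lookup (encode H) a) {a = u} {b = v} e
  ... | inj₁ v∈ = ∈-encode⁻ v∈
  ... | inj₂ u∈ = Edge-sym H (∈-encode⁻ u∈)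
  H⊆decoded : H ⊆ᴱ decode (encode H)
  H⊆decoded u v e = Edge-graphOf⁺ (λ a b → b ∈? lookup (encode H) a)
    (inj₁ (subst (_ ∈_) (sym (lookup∘tabulate (nbhd H) u)) (∈-tabulate⁺ (adj H u) e))) (Edge-irrefl H e)

leaf-preserved : ∀ {H T : Graph n} → (∀ u v → Edge H u v → u ∈ X) → SpanningTreeOn H X T →
                 ∀ {v} → degree H v ≡ 1 → degree T v ≡ 1
leaf-preserved {H = H} {T} H-inside (T⊆H , _ , (_ , T-walk) , _) {v} deg≡1 with degree≡1⇒neighbour H deg≡1
... | a , e with T-walk v a (H-inside v a e) (H-inside a v (Edge-sym H e))
...   | here _ = ⊥-elim (Edge-irrefl H e refl)
...   | step _ e-T _ = degree≡1⁺ T e-T λ e₁ e₂ →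
  degree≤1⇒unique H (≤-reflexive deg≡1) (T⊆H _ _ e₁) (T⊆H _ _ e₂)

encode-spanning : ∀ G X (T : Graph n) → SpanningTreeOn G X T → ConnectedSpanning G X (decode (encode T))
encode-spanning G X T tree =
  ConnectedSpanning-resp (encode-decode T) (SpanningTreeOn⇒ConnectedSpanning tree)

IsMaxLeaf-exists : ∀ (G : Graph n) X → ConnectedSet G X → ∃ (IsMaxLeaf G X)
IsMaxLeaf-exists {n} G X connected with spanning-tree-exists connected
... | T₀ , tree₀
  with argmax (Vec-searchable anySubset? n) (leaves ∘ decode) (λ E → ∣p∣≤n (leafSet (decode E)))
              (ConnectedSpanning? G X ∘ decode) {encode T₀} (encode-spanning G X T₀ tree₀)
... | E , connectedSpanning H⊆G H-inside H-connected , maximal with spanning-tree-exists H-connected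
... | T , tree@(T⊆H , T-rest) =
  leaves T , (T , ((λ u v → H⊆G u v ∘ T⊆H u v) , T-rest) , refl) , λ T′ tree′ → ≤-trans (T′≤H T′ tree′) H≤T
  where
  H≤T : leaves (decode E) ≤ leaves T
  H≤T = p⊆q⇒∣p∣≤∣q∣ λ v∈ →
    ∈leafSet⁺ T (leaf-preserved {H = decode E} {T} H-inside tree (∈leafSet⁻ (decode E) v∈))
  T′≤H : ∀ T′ → SpanningTreeOn G X T′ → leaves T′ ≤ leaves (decode E)
  T′≤H T′ tree′ = ≤-trans (≤-reflexive (SameEdges⇒leaves≡ (encode-decode T′)))
                          (maximal {encode T′} (encode-spanning G X T′ tree′))

-- The lower bound

module _ {G T : Graph n} {X : Subset n} (spanning : ConnectedSpanning G X T) where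

  open ConnectedSpanning spanning

  AgreesOffLeaves : ConceptClass n
  AgreesOffLeaves Q = ∀ v → v ∉ leafSet T → lookup Q v ≡ lookup X v

  AgreesOffLeaves-flip-closed : FlipClosed AgreesOffLeaves (leafSet T)
  AgreesOffLeaves-flip-closed Q x agrees x∈L v v∉L =
    trans (lookup∘updateAt′ v x (λ { refl → v∉L x∈L }) Q) (agrees v v∉L)

  module _ {Q} (agrees : AgreesOffLeaves Q) where

    non-member-is-leaf : v ∈ X → v ∉ Q → v ∈ leafSet T
    non-member-is-leaf {v} v∈X v∉Q = decidable-stable (v ∈? leafSet T) λ v∉L →
      v∉Q (lookup⇒[]= v Q (trans (agrees v v∉L) ([]=⇒lookup v∈X)))

    Q⊆X : Q ⊆ X
    Q⊆X {v} v∈Q with v ∈? leafSet T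
    ... | yes v∈L = edges-in v _ (proj₂ (degree≡1⇒neighbour T (∈leafSet⁻ T v∈L)))
    ... | no v∉L = lookup⇒[]= v X (trans (sym (agrees v v∉L)) ([]=⇒lookup v∈Q))

    Tail : Fin n → Fin n → Set
    Tail a w = a ≡ w ⊎ ∃ λ b → Edge T a b × PathIn T Q b w

    walk⇒Tail : PathIn T Q a w → Tail a w
    walk⇒Tail (here _)     = inj₁ refl
    walk⇒Tail (step _ e p) = inj₂ (_ , e , p)

    -- Members of X outside Q are leaves of T, so a walk between members of Q never needs them.
    Tail-in-Q : PathIn T X a w → w ∈ Q → Tail a w
    Tail-in-Q (here _) _ = inj₁ refl
    Tail-in-Q {a} (step {v = b} _ e-ab p) w∈Q with Tail-in-Q p w∈Q
    ... | inj₁ refl = inj₂ (b , e-ab , here w∈Q)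
    ... | inj₂ (c , e-bc , q) with b ∈? Q
    ...   | yes b∈Q = inj₂ (b , e-ab , step b∈Q e-bc q)
    ...   | no b∉Q with degree≤1⇒unique T (≤-reflexive (∈leafSet⁻ T (non-member-is-leaf (walk-start∈ p) b∉Q)))
                                         (Edge-sym T e-ab) e-bc
    ...     | refl = walk⇒Tail q

    AgreesOffLeaves⇒Ccon : Ccon G Q
    AgreesOffLeaves⇒Ccon with nonempty? Q
    ... | no empty = inj₁ (Empty-unique empty)
    ... | yes nonempty = inj₂ (nonempty , λ u w u∈ w∈ →
      walk-map ⊆G id (Tail⇒walk u∈ (Tail-in-Q (proj₂ connected u w (Q⊆X u∈) (Q⊆X w∈)) w∈)))
      where
      Tail⇒walk : ∀ {u w} → u ∈ Q → Tail u w → PathIn T Q u w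
      Tail⇒walk u∈Q (inj₁ refl)          = here u∈Q
      Tail⇒walk u∈Q (inj₂ (_ , e , q)) = step u∈Q e q

  leaves≤RTD : ∀ {d} → RTDis (Ccon G) d → leaves T ≤ d
  leaves≤RTD rtd =
    RTD-≥ {𝒬 = AgreesOffLeaves} rtd AgreesOffLeaves⇒Ccon AgreesOffLeaves-flip-closed (X , λ _ _ → refl)

-- Trees

spanning-tree-of-tree : Acyclic T → SpanningTreeOn T Full T* → SameEdges T* T
spanning-tree-of-tree {T = T} {T* = T*} acyclic (T*⊆T , _ , (_ , T*-walk) , _) = sameEdges T*⊆T T⊆T*
  where
  T⊆T* : T ⊆ᴱ T*
  T⊆T* u v e with shortcut (T*-walk u v ∈⊤ ∈⊤)
  ... | here _ , _ = ⊥-elim (Edge-irrefl T e refl)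
  ... | step _ e* (here _) , _ = e*
  ... | q@(step _ _ (step _ _ _)) , simple , _ =
    ⊥-elim (no-closing-edge acyclic (walk-map T*⊆T id q) (Simple-walk-map {H = T} T*⊆T id q simple)
             (subst (2 ≤_) (sym (length-walk-map {H = T} T*⊆T id q)) (s≤s (s≤s z≤n))) (Edge-sym T e))

induced : Graph n → Subset n → Graph n
induced G C = graphOf λ a b → edge? G a b ×-dec (a ∈? C) ×-dec (b ∈? C)

Edge-induced⁺ : ∀ (G : Graph n) {C a b} → Edge G a b → a ∈ C → b ∈ C → Edge (induced G C) a b
Edge-induced⁺ G {C} e a∈C b∈C =
  Edge-graphOf⁺ (λ a b → edge? G a b ×-dec (a ∈? C) ×-dec (b ∈? C)) (inj₁ (e , a∈C , b∈C)) (Edge-irrefl G e)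

Edge-induced⁻ : ∀ (G : Graph n) {C a b} → Edge (induced G C) a b → Edge G a b × a ∈ C × b ∈ C
Edge-induced⁻ G {C} {a} {b} e
  with Edge-graphOf⁻ (λ a b → edge? G a b ×-dec (a ∈? C) ×-dec (b ∈? C)) {a = a} {b = b} e
... | inj₁ r = r
... | inj₂ (e′ , b∈C , a∈C) = Edge-sym G e′ , a∈C , b∈C

induced⊆ : ∀ (G : Graph n) C → induced G C ⊆ᴱ G
induced⊆ G C a b e = proj₁ (Edge-induced⁻ G {C} {a} {b} e)

induced-spanning-tree : ∀ {G : Graph n} {C} → Acyclic G → ConnectedSet G C → SpanningTreeOn G C (induced G C)
induced-spanning-tree {G = G} {C} acyclic (nonempty , G-walk) =
  induced⊆ G C , (λ a b e → proj₁ (proj₂ (Edge-induced⁻ G {C} {a} {b} e))) ,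
  (nonempty , λ u v u∈ v∈ → induced-walk (G-walk u v u∈ v∈)) ,
  Acyclic-sub {H = induced G C} {G = G} (induced⊆ G C) acyclic
  where
  induced-walk : ∀ {u v} → PathIn G C u v → PathIn (induced G C) C u v
  induced-walk (here u∈C)     = here u∈C
  induced-walk (step u∈C e p) = step u∈C (Edge-induced⁺ G e u∈C (walk-start∈ p)) (induced-walk p)

-- the leaves of the subtree T[C], an isolated vertex counting as a leaf
subtreeLeaves : Graph n → Subset n → Subset n
subtreeLeaves T C = ⟦ (λ x → (x ∈? C) ×-dec (degree (induced T C) x ℕ.≤? 1)) ⟧

∈subtreeLeaves⁺ : ∀ (T : Graph n) {C x} → x ∈ C → degree (induced T C) x ≤ 1 → x ∈ subtreeLeaves T C
∈subtreeLeaves⁺ T {C} x∈C deg≤1 = ∈⟦⟧⁺ (λ x → (x ∈? C) ×-dec (degree (induced T C) x ℕ.≤? 1)) (x∈C , deg≤1)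

∈subtreeLeaves⁻ : ∀ (T : Graph n) {C x} → x ∈ subtreeLeaves T C → x ∈ C × degree (induced T C) x ≤ 1
∈subtreeLeaves⁻ T {C} = ∈⟦⟧⁻ (λ x → (x ∈? C) ×-dec (degree (induced T C) x ℕ.≤? 1))

two-vertices : 2 ≤ n → ∃ λ (x : Fin n) → ∃ λ y → x ≢ y
two-vertices (s≤s (s≤s _)) = zero , suc zero , λ ()

module _ {T : Graph n} (tree : IsTree T) where

  subtree-leaves≤ : ∀ {Y T₀} → SpanningTreeOn T Y T₀ → leaves T₀ ≤ leaves T
  subtree-leaves≤ subtree with grow (proj₁ tree) (λ _ → ∈⊤) subtree
  ... | T* , tree* , _ , leaves≤ =
    ≤-trans leaves≤ (≤-reflexive (SameEdges⇒leaves≡ (spanning-tree-of-tree {T = T} {T* = T*} (proj₂ tree) tree*)))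

  tree-has-leaf : 2 ≤ n → 0 < leaves T
  tree-has-leaf 2≤n with two-vertices 2≤n
  ... | x , y , x≢y with proj₂ (proj₁ tree) x y ∈⊤ ∈⊤
  ...   | here _ = ⊥-elim (x≢y refl)
  ...   | step {v = a} _ e _ =
    ≤-trans (x∈p⇒0<∣p∣ {p = leafSet T′} (∈leafSet⁺ T′ {a} degree-w)) (subtree-leaves≤ tree′)
    where
    open GrowthStep {H = T} {T = emptyGraph} {Y = ⁅ x ⁆} (singleton-tree T x) {u = x} {w = a} (x∈⁅x⁆ x)
                    (λ a∈ → Edge-irrefl T e (sym (x∈⁅y⁆⇒x≡y x a∈))) e

  subtreeLeaves≤leaves : 2 ≤ n → ∀ {C} → ConnectedSet T C → ∣ subtreeLeaves T C ∣ ≤ leaves T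
  subtreeLeaves≤leaves 2≤n {C} C-connected@(_ , T-walk)
    with any? (λ x → (x ∈? C) ×-dec (degree (induced T C) x ℕ.≟ 0))
  ... | yes (x , x∈C , isolated) = begin
    ∣ subtreeLeaves T C ∣ ≤⟨ p⊆q⇒∣p∣≤∣q∣ (proj₁ ∘ ∈subtreeLeaves⁻ T) ⟩
    ∣ C ∣                 ≤⟨ p⊆q⇒∣p∣≤∣q∣ C⊆x ⟩
    ∣ ⁅ x ⁆ ∣             ≡⟨ ∣⁅x⁆∣≡1 x ⟩
    1                     ≤⟨ tree-has-leaf 2≤n ⟩
    leaves T              ∎
    where
    open ≤-Reasoning
    C⊆x : C ⊆ ⁅ x ⁆
    C⊆x {y} y∈C with T-walk x y x∈C y∈C
    ... | here _ = x∈⁅x⁆ x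
    ... | step _ e p = contradiction isolated
          (≢-sym (<⇒≢ (Edge⇒0<degree (induced T C) (Edge-induced⁺ T e x∈C (walk-start∈ p)))))
  ... | no ∄isolated = begin
    ∣ subtreeLeaves T C ∣    ≤⟨ p⊆q⇒∣p∣≤∣q∣ subtree-leaf⇒leaf ⟩
    leaves (induced T C)  ≤⟨ subtree-leaves≤ (induced-spanning-tree (proj₂ tree) C-connected) ⟩
    leaves T              ∎
    where
    open ≤-Reasoning
    subtree-leaf⇒leaf : subtreeLeaves T C ⊆ leafSet (induced T C)
    subtree-leaf⇒leaf v∈ with ∈subtreeLeaves⁻ T v∈
    ... | v∈C , deg≤1 =
      ∈leafSet⁺ (induced T C) (≤-antisym deg≤1 (n≢0⇒n>0 λ deg≡0 → ∄isolated (_ , v∈C , deg≡0)))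

two-neighbours-in : ∀ (T : Graph n) C {y} → ¬ degree (induced T C) y ≤ 1 →
  ∃ λ z₁ → ∃ λ z₂ → z₁ ≢ z₂ × (Edge T y z₁ × z₁ ∈ C) × (Edge T y z₂ × z₂ ∈ C)
two-neighbours-in T C {y} deg≰1 with 2≤∣p∣⇒distinct {p = nbhd (induced T C) y} (≰⇒> deg≰1)
... | z₁ , z₂ , z₁∈ , z₂∈ , z₁≢z₂
  with Edge-induced⁻ T (∈-tabulate⁻ _ z₁∈) | Edge-induced⁻ T (∈-tabulate⁻ _ z₂∈)
...   | e₁ , _ , z₁∈C | e₂ , _ , z₂∈C = z₁ , z₂ , z₁≢z₂ , (e₁ , z₁∈C) , (e₂ , z₂∈C)

module WalkAway {T : Graph n} (acyclic : Acyclic T) (C : Subset n) (x : Fin n) where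

  -- the successor of y on q, or x when q is trivial: the neighbour of y the walk must not return to
  toward-x : ∀ {y a} → PathIn T (C - x) y a → Fin n
  toward-x (here _)             = x
  toward-x (step {v = s} _ _ _) = s

  ∉ʷ-x : ∀ {y a} (q : PathIn T (C - x) y a) → ¬ x ∈ʷ q
  ∉ʷ-x q x∈q = x∈p-y⇒x≢y {p = C} (∈ʷ⇒∈ q x∈q) refl

  back-to-x-impossible : ∀ {y a} (q : PathIn T (C - x) y a) → Simple q → Edge T a x → Edge T y x →
                         ¬ x ≢ toward-x q
  back-to-x-impossible (here _) _ _ _ x≢x = x≢x refl
  back-to-x-impossible q@(step _ _ p) simple@(y∉p , _) e-ax e-yx _ =
    no-apex acyclic q simple (∉ʷ-x q) (λ { refl → y∉p (end-∈ʷ p) }) (Edge-sym T e-yx) e-ax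

  off-walk : ∀ {y a z} (q : PathIn T (C - x) y a) → Simple q → Edge T y z → z ≢ toward-x q → ¬ z ∈ʷ q
  off-walk (here _)       _      e-yz _   refl        = Edge-irrefl T e-yz refl
  off-walk (step _ _ _)   _      e-yz _   (inj₁ refl) = Edge-irrefl T e-yz refl
  off-walk (step y∈ e p)  simple e-yz z≢s (inj₂ z∈p)  =
    no-chord-back acyclic y∈ e p simple z∈p z≢s (Edge-sym T e-yz)

  to-subtree-leaf : ∀ fuel {y a} (q : PathIn T (C - x) y a) → Simple q → Edge T a x → n ≤ length q + fuel →
    ∃ λ d → d ∈ subtreeLeaves T C × PathIn T (C - x) a d
  to-subtree-leaf zero q simple _ n≤ =
    contradiction (≤-trans n≤ (≤-reflexive (+-identityʳ _))) (<⇒≱ (simple-length< q simple))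
  to-subtree-leaf (suc fuel) {y} q simple e-ax n≤ with degree (induced T C) y ℕ.≤? 1
  ... | yes deg≤1 =
    y , ∈subtreeLeaves⁺ T (x∈p-y⇒x∈p {p = C} (walk-start∈ q)) deg≤1 , walk-reverse q
  ... | no deg≰1 = extend (away (two-neighbours-in T C deg≰1))
    where
    away : (∃ λ z₁ → ∃ λ z₂ → z₁ ≢ z₂ × (Edge T y z₁ × z₁ ∈ C) × (Edge T y z₂ × z₂ ∈ C)) →
           ∃ λ z → z ≢ toward-x q × Edge T y z × z ∈ C
    away (z₁ , z₂ , z₁≢z₂ , (e₁ , z₁∈C) , (e₂ , z₂∈C)) with z₁ ≟ toward-x q
    ... | yes refl = z₂ , z₁≢z₂ ∘ sym , e₂ , z₂∈C
    ... | no z₁≢ = z₁ , z₁≢ , e₁ , z₁∈C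
    extend : (∃ λ z → z ≢ toward-x q × Edge T y z × z ∈ C) →
             ∃ λ d → d ∈ subtreeLeaves T C × PathIn T (C - x) _ d
    extend (z , z≢ , e-yz , z∈C) =
      to-subtree-leaf fuel (step z∈C-x (Edge-sym T e-yz) q) (off-walk q simple e-yz z≢ , simple) e-ax
                      (≤-trans n≤ (≤-reflexive (+-suc _ _)))
      where
      z∈C-x : z ∈ C - x
      z∈C-x = x∈p∧x≢y⇒x∈p-y z∈C λ { refl → back-to-x-impossible q simple e-ax e-yz z≢ }

  reach-subtree-leaf : ∀ {a} → a ∈ C → Edge T a x → ∃ λ d → d ∈ subtreeLeaves T C × PathIn T (C - x) a d
  reach-subtree-leaf a∈C e-ax =
    to-subtree-leaf n (here (x∈p∧x≢y⇒x∈p-y a∈C (Edge-irrefl T e-ax))) tt e-ax ≤-refl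

subtreeLeaves-⊆⇒⊆ : Acyclic T → ∀ {C C′} → Ccon T C′ → subtreeLeaves T C ⊆ C′ → C ⊆ C′
subtreeLeaves-⊆⇒⊆ {T = T} acyclic {C} {C′} C′-con leaves⊆C′ {x} x∈C with degree (induced T C) x ℕ.≤? 1
... | yes deg≤1 = leaves⊆C′ (∈subtreeLeaves⁺ T x∈C deg≤1)
... | no deg≰1 = decidable-stable (x ∈? C′) (x∉C′-impossible (two-neighbours-in T C deg≰1))
  where
  open WalkAway {T = T} acyclic C x
  C′-walk : ∀ {d d′} → d ∈ C′ → d′ ∈ C′ → PathIn T C′ d d′
  C′-walk d∈ d′∈ = [ (λ { refl → ⊥-elim (∉⊥ d∈) }) , (λ (_ , walk) → walk _ _ d∈ d′∈) ]′ C′-con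
  C-x⊆ : C - x ⊆ Full - x
  C-x⊆ y∈ = x∈p∧x≢y⇒x∈p-y ∈⊤ (x∈p-y⇒x≢y {p = C} y∈)
  x∉C′-impossible : (∃ λ a → ∃ λ b → a ≢ b × (Edge T x a × a ∈ C) × (Edge T x b × b ∈ C)) → ¬ x ∉ C′
  x∉C′-impossible (a , b , a≢b , (e-xa , a∈C) , (e-xb , b∈C)) x∉C′ =
    no-apex acyclic path simple (λ x∈ → x∈p-y⇒x≢y {p = Full} (∈ʷ⇒∈ path x∈) refl) a≢b e-xa (Edge-sym T e-xb)
    where
    C′⊆ : C′ ⊆ Full - x
    C′⊆ y∈ = x∈p∧x≢y⇒x∈p-y ∈⊤ λ { refl → x∉C′ y∈ }
    from-a = reach-subtree-leaf a∈C (Edge-sym T e-xa)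
    from-b = reach-subtree-leaf b∈C (Edge-sym T e-xb)
    a→b : PathIn T (Full - x) a b
    a→b = walk-⊆ C-x⊆ (proj₂ (proj₂ from-a))
       ++ʷ walk-⊆ C′⊆ (C′-walk (leaves⊆C′ (proj₁ (proj₂ from-a))) (leaves⊆C′ (proj₁ (proj₂ from-b))))
       ++ʷ walk-reverse (walk-⊆ C-x⊆ (proj₂ (proj₂ from-b)))
    path : PathIn T (Full - x) a b
    path = proj₁ (shortcut a→b)
    simple : Simple path
    simple = proj₁ (proj₂ (shortcut a→b))

Empty-teaches-if-maximal : ∀ {𝒮 : ConceptClass n} → 𝒮 Empty → (∀ {C} → 𝒮 C → ∣ C ∣ ≤ ∣ Empty {n} ∣) →
                           Teaches 𝒮 Empty Empty
Empty-teaches-if-maximal _ maximal C′ c′ C′≢Empty = ⊥-elim (C′≢Empty (sym (⊆∧∣∣≤⇒≡ ⊥⊆ (maximal c′))))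

tree-teachable : ∀ {n} {T : Graph n} → IsTree T → 2 ≤ n → TeachableWithin (Ccon T) (leaves T)
tree-teachable {n} {T} tree 2≤n {𝒮} 𝒮? 𝒮⊆Ccon (_ , s₀) with argmax anySubset? ∣_∣ ∣p∣≤n 𝒮? s₀
... | C , c , maximal with 𝒮⊆Ccon c
...   | inj₁ refl =
  Empty , c , Empty , Empty-teaches-if-maximal c maximal , ≤-trans (≤-reflexive (∣⊥∣≡0 n)) z≤n
...   | inj₂ C-connected = C , c , subtreeLeaves T C , teaches , subtreeLeaves≤leaves tree 2≤n C-connected
  where
  teaches : Teaches 𝒮 C (subtreeLeaves T C)
  teaches C′ c′ C′≢C with any? (λ y → (y ∈? subtreeLeaves T C) ×-dec ¬? (y ∈? C′))
  ... | yes (y , y∈L , y∉C′) = y , y∈L , inj₁ (proj₁ (∈subtreeLeaves⁻ T y∈L) , y∉C′)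
  ... | no ∄ = ⊥-elim (C′≢C (sym (⊆∧∣∣≤⇒≡ (subtreeLeaves-⊆⇒⊆ (proj₂ tree) (𝒮⊆Ccon c′) L⊆C′) (maximal c′))))
    where
    L⊆C′ : subtreeLeaves T C ⊆ C′
    L⊆C′ {y} y∈L = decidable-stable (y ∈? C′) λ y∉C′ → ∄ (y , y∈L , y∉C′)

RTD-tree : ∀ {n} {T : Graph n} → 2 ≤ n → IsTree T → RTDis (Ccon T) (leaves T)
RTD-tree {T = T} 2≤n tree = exact (RTD-exists (Ccon? T) (Empty , inj₁ refl))
  where
  exact : ∃ (RTDis (Ccon T)) → RTDis (Ccon T) (leaves T)
  exact (d , rtd) = subst (RTDis (Ccon T)) (≤-antisym d≤leaves (leaves≤RTD T-spans-T rtd)) rtd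
    where
    d≤leaves : d ≤ leaves T
    d≤leaves = RTD-≤ {k = leaves T} rtd (Ccon? T) (tree-teachable tree 2≤n)
    T-spans-T : ConnectedSpanning T Full T
    T-spans-T = connectedSpanning (λ _ _ → id) (λ _ _ _ → ∈⊤) (proj₁ tree)

-- Components and the upper bound for graphs

opaque
  reach : Graph n → Fin n → Subset n
  reach G v = ⟦ walk? G Full v ⟧

  ∈reach⁺ : PathIn G Full v w → w ∈ reach G v
  ∈reach⁺ {G = G} {v = v} = ∈⟦⟧⁺ (walk? G Full v)

  ∈reach⁻ : w ∈ reach G v → PathIn G Full v w
  ∈reach⁻ {w = w} {G = G} {v = v} = ∈⟦⟧⁻ (walk? G Full v)

reach-connected : ∀ (G : Graph n) v → ConnectedSet G (reach G v)
reach-connected G v = (v , ∈reach⁺ (here ∈⊤)) , λ a b a∈ b∈ →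
  walk-closed closed a∈ (walk-reverse (∈reach⁻ a∈) ++ʷ ∈reach⁻ b∈)
  where
  closed : ∀ {a b} → Edge G a b → a ∈ reach G v → b ∈ reach G v
  closed e a∈ = ∈reach⁺ (walk-snoc (∈reach⁻ a∈) e ∈⊤)

connected⊆reach : ConnectedSet G X → v ∈ X → X ⊆ reach G v
connected⊆reach (_ , G-walk) v∈X w∈X = ∈reach⁺ (walk-⊆ (λ _ → ∈⊤) (G-walk _ _ v∈X w∈X))

reach-component : ∀ (G : Graph n) v → Component G (reach G v)
reach-component G v = reach-connected G v , λ Y Y-connected reach⊆Y →
  ⊆-antisym (connected⊆reach Y-connected (reach⊆Y (∈reach⁺ (here ∈⊤)))) reach⊆Y

component≡reach : Component G X → v ∈ X → X ≡ reach G v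
component≡reach {G = G} {v = v} (X-connected , maximal) v∈X =
  sym (maximal (reach G v) (reach-connected G v) (connected⊆reach X-connected v∈X))

IsMaxLeaf-unique : ∀ {k k′} → IsMaxLeaf G X k → IsMaxLeaf G X k′ → k ≡ k′
IsMaxLeaf-unique ((T , tree , refl) , maximal) ((T′ , tree′ , refl) , maximal′) =
  ≤-antisym (maximal′ T tree) (maximal T′ tree′)

module LeafNumber (G : Graph n) where

  opaque
    ℓ : Fin n → ℕ
    ℓ v = proj₁ (IsMaxLeaf-exists G (reach G v) (reach-connected G v))

    ℓ-IsMaxLeaf : ∀ v → IsMaxLeaf G (reach G v) (ℓ v)
    ℓ-IsMaxLeaf v = proj₂ (IsMaxLeaf-exists G (reach G v) (reach-connected G v))

  ℓ≤n : ∀ v → ℓ v ≤ n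
  ℓ≤n v with ℓ-IsMaxLeaf v
  ... | (T , _ , leaves≡) , _ = subst (_≤ n) leaves≡ (∣p∣≤n (leafSet T))

  max-ℓ : ∃ λ M → (∀ v → ℓ v ≤ M) × (M ≡ 0 ⊎ ∃ λ v → ℓ v ≡ M)
  max-ℓ = maximum ℓ ℓ≤n

  M : ℕ
  M = proj₁ max-ℓ

  M-IsLeafNumber : IsLeafNumber G M
  M-IsLeafNumber = bounded , witnessed (proj₂ (proj₂ max-ℓ))
    where
    bounded : ∀ X k → Component G X → IsMaxLeaf G X k → k ≤ M
    bounded X k component max-leaf with proj₁ (proj₁ component)
    ... | v , v∈X rewrite component≡reach component v∈X =
      subst (_≤ M) (IsMaxLeaf-unique {G = G} {X = reach G v} (ℓ-IsMaxLeaf v) max-leaf) (proj₁ (proj₂ max-ℓ) v)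
    witnessed : (M ≡ 0 ⊎ ∃ λ v → ℓ v ≡ M) → M ≡ 0 ⊎ ∃ λ X → Component G X × IsMaxLeaf G X M
    witnessed (inj₁ M≡0) = inj₁ M≡0
    witnessed (inj₂ (v , ℓv≡M)) =
      inj₂ (reach G v , reach-component G v , subst (IsMaxLeaf G (reach G v)) ℓv≡M (ℓ-IsMaxLeaf v))

  M≤RTD : ∀ {d} → RTDis (Ccon G) d → M ≤ d
  M≤RTD rtd with proj₂ (proj₂ max-ℓ)
  ... | inj₁ M≡0 = subst (_≤ _) (sym M≡0) z≤n
  ... | inj₂ (v , ℓv≡M) with ℓ-IsMaxLeaf v
  ...   | (T , tree , leaves≡) , _ =
    subst (_≤ _) (trans leaves≡ ℓv≡M) (leaves≤RTD (SpanningTreeOn⇒ConnectedSpanning tree) rtd)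

  module Neighbourhood {C : Subset n} (C-connected : ConnectedSet G C) {c} (c∈C : c ∈ C) where

    IsNeighbour : Fin n → Set
    IsNeighbour y = y ∉ C × ∃ λ p → p ∈ C × Edge G p y

    neighbourhood : Subset n
    neighbourhood = ⟦ (λ y → ¬? (y ∈? C) ×-dec any? λ p → (p ∈? C) ×-dec edge? G p y) ⟧

    ∈neighbourhood⁺ : ∀ {y} → IsNeighbour y → y ∈ neighbourhood
    ∈neighbourhood⁺ = ∈⟦⟧⁺ (λ y → ¬? (y ∈? C) ×-dec any? λ p → (p ∈? C) ×-dec edge? G p y)

    ∈neighbourhood⁻ : ∀ {y} → y ∈ neighbourhood → IsNeighbour y
    ∈neighbourhood⁻ = ∈⟦⟧⁻ (λ y → ¬? (y ∈? C) ×-dec any? λ p → (p ∈? C) ×-dec edge? G p y)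

    closure : Subset n
    closure = C ∪ neighbourhood

    C⊆closure : C ⊆ closure
    C⊆closure = p⊆p∪q neighbourhood

    N⊆closure : neighbourhood ⊆ closure
    N⊆closure = q⊆p∪q C neighbourhood

    -- only the edges of G leaving C, so that every neighbour ends up as a leaf
    Gout : Graph n
    Gout = graphOf λ a b → edge? G a b ×-dec (a ∈? C) ×-dec (b ∈? closure)

    Edge-Gout⁺ : ∀ {a b} → Edge G a b → a ∈ C → b ∈ closure → Edge Gout a b
    Edge-Gout⁺ e a∈ b∈ = Edge-graphOf⁺ (λ a b → edge? G a b ×-dec (a ∈? C) ×-dec (b ∈? closure))
                                    (inj₁ (e , a∈ , b∈)) (Edge-irrefl G e)

    Gout⊆G : Gout ⊆ᴱ G
    Gout⊆G a b e
      with Edge-graphOf⁻ (λ a b → edge? G a b ×-dec (a ∈? C) ×-dec (b ∈? closure)) {a = a} {b = b} e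
    ... | inj₁ (e′ , _) = e′
    ... | inj₂ (e′ , _) = Edge-sym G e′

    Gout-edge-outside : ∀ {a b} → Edge Gout a b → a ∉ C → b ∈ C
    Gout-edge-outside {a} {b} e a∉C
      with Edge-graphOf⁻ (λ a b → edge? G a b ×-dec (a ∈? C) ×-dec (b ∈? closure)) {a = a} {b = b} e
    ... | inj₁ (_ , a∈C , _) = contradiction a∈C a∉C
    ... | inj₂ (_ , b∈C , _) = b∈C

    C-walk-in-Gout : ∀ {a b} → PathIn G C a b → PathIn Gout C a b
    C-walk-in-Gout (here a∈C)     = here a∈C
    C-walk-in-Gout (step a∈C e p) = step a∈C (Edge-Gout⁺ e a∈C (C⊆closure (walk-start∈ p))) (C-walk-in-Gout p)

    Gout-connected : ConnectedSet Gout closure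
    Gout-connected = (c , C⊆closure c∈C) , λ a b a∈ b∈ → walk-reverse (to-c a∈) ++ʷ to-c b∈
      where
      c→ : ∀ {y} → y ∈ C → PathIn Gout closure c y
      c→ y∈C = walk-⊆ C⊆closure (C-walk-in-Gout (proj₂ C-connected _ _ c∈C y∈C))
      to-c : ∀ {y} → y ∈ closure → PathIn Gout closure c y
      to-c {y} y∈ with x∈p∪q⁻ C neighbourhood y∈
      ... | inj₁ y∈C = c→ y∈C
      ... | inj₂ y∈N with ∈neighbourhood⁻ y∈N
      ...   | _ , p , p∈C , e = walk-snoc (c→ p∈C) (Edge-Gout⁺ e p∈C y∈) y∈

    private
      tree-C : ∃ (SpanningTreeOn Gout C)
      tree-C = spanning-tree-exists
        (proj₁ C-connected , λ a b a∈ b∈ → C-walk-in-Gout (proj₂ C-connected a b a∈ b∈))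

      T₁ : Graph n
      T₁ = proj₁ tree-C

      grown : ∃ (Extends Gout closure T₁)
      grown = grow Gout-connected C⊆closure (proj₂ tree-C)

      T₂ : Graph n
      T₂ = proj₁ grown

      T₂-spans : SpanningTreeOn Gout closure T₂
      T₂-spans = proj₁ (proj₂ grown)

    neighbour-leaf : ∀ {y} → y ∈ neighbourhood → degree T₂ y ≡ 1
    neighbour-leaf y∈N =
      leaf-outside (proj₁ (proj₂ (proj₂ (proj₂ tree-C)))) (proj₁ (proj₂ (proj₂ grown))) C⊆closure
                   (proj₁ (proj₂ (proj₂ T₂-spans))) (proj₂ (proj₂ (proj₂ T₂-spans)))
                   (N⊆closure y∈N) y∉C (λ e → Gout-edge-outside (proj₁ T₂-spans _ _ e) y∉C)
      where y∉C = proj₁ (∈neighbourhood⁻ y∈N)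

    neighbourhood≤M : ∣ neighbourhood ∣ ≤ M
    neighbourhood≤M = begin
      ∣ neighbourhood ∣ ≤⟨ p⊆q⇒∣p∣≤∣q∣ (∈leafSet⁺ T₂ ∘ neighbour-leaf) ⟩
      leaves T₂         ≤⟨ proj₂ (proj₂ (proj₂ grown-in-G)) ⟩
      leaves T₃         ≤⟨ proj₂ (ℓ-IsMaxLeaf c) T₃ (proj₁ (proj₂ grown-in-G)) ⟩
      ℓ c               ≤⟨ proj₁ (proj₂ max-ℓ) c ⟩
      M                 ∎
      where
      open ≤-Reasoning
      tree₂ : SpanningTreeOn G closure T₂
      tree₂ = (λ a b → Gout⊆G a b ∘ proj₁ T₂-spans a b) , proj₂ T₂-spans
      closure⊆reach : closure ⊆ reach G c
      closure⊆reach = connected⊆reach (proj₁ Gout-connected , λ a b a∈ b∈ →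
        walk-map Gout⊆G id (proj₂ Gout-connected a b a∈ b∈)) (C⊆closure c∈C)
      grown-in-G : ∃ (Extends G (reach G c) T₂)
      grown-in-G = grow (reach-connected G c) closure⊆reach tree₂
      T₃ : Graph n
      T₃ = proj₁ grown-in-G

    c∈N∪c : c ∈ neighbourhood ∪ ⁅ c ⁆
    c∈N∪c = x∈p∪q⁺ (inj₂ (x∈⁅x⁆ c))

    neighbourhood-teaches : ∀ {𝒮} → (∀ {C′} → 𝒮 C′ → Ccon G C′) →
      (∀ {C′} → 𝒮 C′ × Nonempty C′ → ∣ C ∣ ≤ ∣ C′ ∣) → Teaches 𝒮 C (neighbourhood ∪ ⁅ c ⁆)
    neighbourhood-teaches 𝒮⊆Ccon minimal C′ c′ C′≢C with nonempty? C′
    ... | no C′-empty = c , c∈N∪c , inj₁ (c∈C , λ c∈C′ → C′-empty (c , c∈C′))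
    ... | yes C′-nonempty with any? (λ y → (y ∈? C′) ×-dec ¬? (y ∈? C))
    ...   | no C′⊆C = ⊥-elim (C′≢C (⊆∧∣∣≤⇒≡
                        (λ {y} y∈C′ → decidable-stable (y ∈? C) λ y∉C → C′⊆C (y , y∈C′ , y∉C))
                        (minimal (c′ , C′-nonempty))))
    ...   | yes (y , y∈C′ , y∉C) with any? (λ z → (z ∈? C′) ×-dec (z ∈? C))
    ...     | no disjoint = c , c∈N∪c , inj₁ (c∈C , λ c∈C′ → disjoint (c , c∈C′ , c∈C))
    ...     | yes (z , z∈C′ , z∈C) with 𝒮⊆Ccon c′
    ...       | inj₁ refl = ⊥-elim (∉⊥ z∈C′)
    ...       | inj₂ (_ , C′-walk) with crossing-edge C (C′-walk z y z∈C′ y∈C′) z∈C y∉C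
    ...         | a , b , a∈C , b∉C , e , _ , b∈C′ =
      b , x∈p∪q⁺ (inj₁ (∈neighbourhood⁺ (b∉C , a , a∈C , e))) , inj₂ (b∉C , b∈C′)

  graph-teachable : TeachableWithin (Ccon G) (suc M)
  graph-teachable {𝒮} 𝒮? 𝒮⊆Ccon (C₀ , c₀) with anySubset? (λ C → 𝒮? C ×-dec nonempty? C)
  ... | no ∄nonempty = C₀ , c₀ , Empty , teaches , ≤-trans (≤-reflexive (∣⊥∣≡0 n)) z≤n
    where
    empty : ∀ {C} → 𝒮 C → C ≡ Empty
    empty {C} c = Empty-unique λ ne → ∄nonempty (C , c , ne)
    teaches : Teaches 𝒮 C₀ Empty
    teaches C′ c′ C′≢C₀ = ⊥-elim (C′≢C₀ (trans (empty c′) (sym (empty c₀))))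
  ... | yes (_ , s₁ , ne₁) with argmin anySubset? ∣_∣ (λ C → 𝒮? C ×-dec nonempty? C) (s₁ , ne₁)
  ...   | C , (c , x , x∈C) , minimal with 𝒮⊆Ccon c
  ...     | inj₁ refl = ⊥-elim (∉⊥ x∈C)
  ...     | inj₂ C-connected =
    C , c , neighbourhood ∪ ⁅ x ⁆ , neighbourhood-teaches 𝒮⊆Ccon minimal ,
    ≤-trans (∣p∪⁅x⁆∣≤1+∣p∣ neighbourhood x) (s≤s neighbourhood≤M)
    where open Neighbourhood C-connected x∈C

RTD-connected-≥ : ∀ (G : Graph n) → ConnectedGraph G →
  ∃ λ d → ∃ λ m → RTDis (Ccon G) d × IsMaxLeaf G Full m × m ≤ d
RTD-connected-≥ G connected =
  combine (RTD-exists (Ccon? G) (Empty , inj₁ refl)) (IsMaxLeaf-exists G Full connected)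
  where
  combine : ∃ (RTDis (Ccon G)) → ∃ (IsMaxLeaf G Full) →
            ∃ λ d → ∃ λ m → RTDis (Ccon G) d × IsMaxLeaf G Full m × m ≤ d
  combine (d , rtd) (m , max-leaf@((T , tree , leaves≡m) , _)) =
    d , m , rtd , max-leaf , subst (_≤ d) leaves≡m (leaves≤RTD (SpanningTreeOn⇒ConnectedSpanning tree) rtd)

RTD-between : ∀ (G : Graph n) → ∃ λ d → ∃ λ m → RTDis (Ccon G) d × IsLeafNumber G m × m ≤ d × d ≤ suc m
RTD-between G = bounds (RTD-exists (Ccon? G) (Empty , inj₁ refl))
  where
  open LeafNumber G
  bounds : ∃ (RTDis (Ccon G)) → ∃ λ d → ∃ λ m → RTDis (Ccon G) d × IsLeafNumber G m × m ≤ d × d ≤ suc m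
  bounds (d , rtd) =
    d , M , rtd , M-IsLeafNumber , M≤RTD rtd , RTD-≤ {k = suc M} rtd (Ccon? G) graph-teachable

theorem6 :
    ((n : ℕ) → 2 ≤ n → (T : Graph n) → IsTree T →
      RTDis (Ccon T) (leaves T)) ×
    ((n : ℕ) → (G : Graph n) → ConnectedGraph G →
      Σ ℕ λ d → Σ ℕ λ m → RTDis (Ccon G) d × IsMaxLeaf G Full m × m ≤ d) ×
    ((n : ℕ) → (G : Graph n) →
      Σ ℕ λ d → Σ ℕ λ m → RTDis (Ccon G) d × IsLeafNumber G m × m ≤ d × d ≤ suc m)
theorem6 = (λ _ 2≤n _ tree → RTD-tree 2≤n tree) , (λ _ → RTD-connected-≥) , (λ _ → RTD-between)
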